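{- Let $m\ge 1$ be an integer. For all integers $n,i\ge 0$, \[ \sum_{k=0}^{n}R_{n,k}^{(m)}(t)\,D_{m}(i+k,t)=t^{n}n!\sum_{j=0}^{i}m^{i-j}\binom{i}{j}S(i-j,n)\,D_{m}(j,t), \] and in particular, for $0\le i\le n$, \[ \sum_{k=0}^{n}R_{n,k}^{(m)}(t)\,D_{m}(i+k,t)=\begin{cases} n!\,m^{n}t^{n}, & i=n,\\ 0, & 0\le i<n.\end{cases} \]
   Context: For a positive integer $m$, $W_{m}(n,k)=\frac{1}{m^{k}k!}\sum_{i=0}^{k}\binom{k}{i}(-1)^{k-i}(mi+1)^{n}$ are the Whitney numbers of the second kind of Dowling lattices, and the Dowling polynomials are $D_m(n,t)=\sum_{k=0}^{n}W_m(n,k)t^k$. The polynomials $R_{n,k}^{(m)}(t)$ are defined by $\sum_{n\ge k}R_{n,k}^{(m)}(t)\frac{z^n}{n!}=e^{ -tz}(1+mz)^{ -1/m}\frac{(\ln(1+mz))^k}{m^k k!}$. $S(n,k)$ are the Stirling numbers of the second kind. -}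

module Defs where

open import Data.Nat as ℕ using (ℕ; zero; suc; _∸_; NonZero)
open import Data.Nat.Properties using (_!≢0; m^n≢0; m*n≢0)
open import Data.Nat.Combinatorics using (_C_)
open import Data.Integer as ℤ using (ℤ; +_)
open import Data.Rational using (ℚ; 0ℚ; 1ℚ; _+_; _*_; _-_; -_; _/_)

ℕ→ℚ : ℕ → ℚ
ℕ→ℚ n = (+ n) / 1

infixr 8 _^ℚ_
_^ℚ_ : ℚ → ℕ → ℚ
x ^ℚ zero  = 1ℚ
x ^ℚ suc n = x * (x ^ℚ n)

invPowFact : (m : ℕ) .{{_ : NonZero m}} → ℕ → ℚ
invPowFact m k = (+ 1) / (m ℕ.^ k ℕ.* k ℕ.!)
  where instance
    _ = m*n≢0 (m ℕ.^ k) (k ℕ.!) {{m^n≢0 m k}} {{k !≢0}}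

invFact : ℕ → ℚ
invFact n = (+ 1) / (n ℕ.!)
  where instance _ = n !≢0

sumTo : ℕ → (ℕ → ℚ) → ℚ
sumTo zero    f = f 0
sumTo (suc n) f = sumTo n f + f (suc n)

prodBelow : ℕ → (ℕ → ℚ) → ℚ
prodBelow zero    f = 1ℚ
prodBelow (suc n) f = prodBelow n f * f n

-- Formal power series over ℚ, as (ordinary) coefficient sequences:
-- a series f stands for  Σ_n f n · z^n.

Series : Set
Series = ℕ → ℚ

_⊛_ : Series → Series → Series
(f ⊛ g) n = sumTo n (λ j → f j * g (n ∸ j))

one : Series
one zero    = 1ℚ
one (suc _) = 0ℚ

_^ˢ_ : Series → ℕ → Series
f ^ˢ zero  = one
f ^ˢ suc k = f ⊛ (f ^ˢ k)

-- e^{-tz} = Σ_n (-t)^n / n! z^n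
expNeg : ℚ → Series
expNeg t n = ((- t) ^ℚ n) * invFact n

-- (1+mz)^{-1/m} = Σ_n binom(-1/m, n) m^n z^n,
-- binom(a,n) = a(a-1)...(a-n+1)/n!
binomSeries : (m : ℕ) .{{_ : NonZero m}} → Series
binomSeries m n =
  prodBelow n (λ j → (ℤ.- (+ 1)) / m - ℕ→ℚ j) * invFact n * (ℕ→ℚ m ^ℚ n)

-- ln(1+mz) = Σ_{n≥1} (-1)^{n-1} m^n / n z^n
logSeries : ℕ → Series
logSeries m zero    = 0ℚ
logSeries m (suc n) = ((- 1ℚ) ^ℚ n) * (ℕ→ℚ m ^ℚ suc n) * ((+ 1) / suc n)

R : (m : ℕ) .{{_ : NonZero m}} → ℕ → ℕ → ℚ → ℚ
R m n k t =
  ℕ→ℚ (n ℕ.!) * ((expNeg t ⊛ (binomSeries m ⊛ (logSeries m ^ˢ k))) n * invPowFact m k)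

W : (m : ℕ) .{{_ : NonZero m}} → ℕ → ℕ → ℚ
W m n k = invPowFact m k *
  sumTo k (λ i → ℕ→ℚ (k C i) * ((- 1ℚ) ^ℚ (k ∸ i)) * ℕ→ℚ ((m ℕ.* i ℕ.+ 1) ℕ.^ n))

D : (m : ℕ) .{{_ : NonZero m}} → ℕ → ℚ → ℚ
D m n t = sumTo n (λ k → W m n k * (t ^ℚ k))

S : ℕ → ℕ → ℕ
S zero    zero    = 1
S zero    (suc k) = 0
S (suc n) zero    = 0
S (suc n) (suc k) = suc k ℕ.* S n (suc k) ℕ.+ S n k

-- Write h_i(y) = (my+1)^i.  As m^k k! W_m(i,k) = Δ^k h_i(0), the Dowling
-- polynomial is D_m(i,t) = Φ(h_i) for the linear functional
-- Φ(g) = Σ_k t^k Δ^k g(0) / (m^k k!) on polynomial functions g : ℕ → ℚ.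
-- With Q_n(y) = Σ_k R_{n,k}(t) h_k(y) and h_{i+k} = h_i h_k the left-hand side
-- is Φ(h_i Q_n).  The central "reduction law"  Φ(g Q_n) = t^n Φ(Δ^n g)  is proved
-- by induction on n from a three-term recurrence for Q_n, which in turn comes
-- from a recurrence for R_{n,k} obtained by applying the derivation (1+mz) d/dz
-- to the generating function.  Finally Δ^n h_i is expanded by the binomial
-- theorem and Δ^n y^r(0) = n! S(r,n); the two special cases follow from
-- S(r,n) = 0 for r < n and S(n,n) = 1.  The file proceeds: fractions, finite
-- sums, power series, the R-recurrence, forward differences, Φ and degrees,
-- the Q-recurrence, the reduction law, the theorem.
module Submission where

open import Defs
open import Data.Nat as ℕ using (ℕ; zero; suc; NonZero; _≤_; _<_; z≤n; s≤s; _∸_)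
import Data.Nat.Properties as NP
open import Data.Nat.Combinatorics using (_C_; k>n⇒nCk≡0; nCk+nC[k+1]≡[n+1]C[k+1])
open import Data.Integer as ℤ using (ℤ; +_)
import Data.Integer.Properties as ZP
open import Data.Product using (_×_; _,_)
open import Data.Rational using (ℚ; toℚᵘ; 0ℚ; 1ℚ; _+_; _*_; _-_; -_; _/_)
import Data.Rational.Properties as QP
open QP using (toℚᵘ-injective; fromℚᵘ-cong; toℚᵘ-fromℚᵘ; toℚᵘ-homo-*; toℚᵘ-homo-+)
open import Data.Rational.Unnormalised as U using (mkℚᵘ; *≡*)
import Data.Rational.Unnormalised.Properties as UP
open import Data.Rational.Solver using (module +-*-Solver)
import Data.Nat.Solver as NS
open import Relation.Binary.PropositionalEquality

open +-*-Solver

/-cross : ∀ (i j : ℤ) c d .{{_ : NonZero c}} .{{_ : NonZero d}} →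
          i ℤ.* (+ d) ≡ j ℤ.* (+ c) → i / c ≡ j / d
/-cross i j (suc c) (suc d) eq = fromℚᵘ-cong {mkℚᵘ i c} {mkℚᵘ j d} (*≡* eq)

toℚᵘ-/ : ∀ i c → toℚᵘ (i / suc c) U.≃ mkℚᵘ i c
toℚᵘ-/ i c = toℚᵘ-fromℚᵘ (mkℚᵘ i c)

/-* : ∀ (i j : ℤ) c d .{{_ : NonZero c}} .{{_ : NonZero d}} →
      (i / c) * (j / d) ≡ ((i ℤ.* j) / (c ℕ.* d)) {{NP.m*n≢0 c d}}
/-* i j (suc c) (suc d) = toℚᵘ-injective
  (UP.≃-trans (toℚᵘ-homo-* (i / suc c) (j / suc d))
  (UP.≃-trans (UP.*-cong (toℚᵘ-/ i c) (toℚᵘ-/ j d))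
   (UP.≃-sym (toℚᵘ-/ (i ℤ.* j) (ℕ.pred (suc c ℕ.* suc d))))))

/-+ : ∀ (i j : ℤ) c d .{{_ : NonZero c}} .{{_ : NonZero d}} →
      (i / c) + (j / d) ≡ ((i ℤ.* + d ℤ.+ j ℤ.* + c) / (c ℕ.* d)) {{NP.m*n≢0 c d}}
/-+ i j (suc c) (suc d) = toℚᵘ-injective
  (UP.≃-trans (toℚᵘ-homo-+ (i / suc c) (j / suc d))
  (UP.≃-trans (UP.+-cong (toℚᵘ-/ i c) (toℚᵘ-/ j d))
   (UP.≃-sym (toℚᵘ-/ _ (ℕ.pred (suc c ℕ.* suc d))))))

ℕ→ℚ-+ : ∀ a b → ℕ→ℚ (a ℕ.+ b) ≡ ℕ→ℚ a + ℕ→ℚ b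
ℕ→ℚ-+ a b = trans (/-cross (+ (a ℕ.+ b)) (+ a ℤ.* + 1 ℤ.+ + b ℤ.* + 1) 1 (1 ℕ.* 1) cross)
                  (sym (/-+ (+ a) (+ b) 1 1))
  where
  cross : + (a ℕ.+ b) ℤ.* + 1 ≡ (+ a ℤ.* + 1 ℤ.+ + b ℤ.* + 1) ℤ.* + 1
  cross = trans (ZP.*-identityʳ (+ (a ℕ.+ b))) (trans (ZP.pos-+ a b)
           (sym (trans (ZP.*-identityʳ (+ a ℤ.* + 1 ℤ.+ + b ℤ.* + 1))
                       (cong₂ ℤ._+_ (ZP.*-identityʳ (+ a)) (ZP.*-identityʳ (+ b))))))

ℕ→ℚ-* : ∀ a b → ℕ→ℚ (a ℕ.* b) ≡ ℕ→ℚ a * ℕ→ℚ b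
ℕ→ℚ-* a b = trans (/-cross (+ (a ℕ.* b)) (+ a ℤ.* + b) 1 (1 ℕ.* 1) (cong (ℤ._* + 1) (ZP.pos-* a b)))
                  (sym (/-* (+ a) (+ b) 1 1))

ℕ→ℚ-^ : ∀ x n → ℕ→ℚ (x ℕ.^ n) ≡ ℕ→ℚ x ^ℚ n
ℕ→ℚ-^ x zero = refl
ℕ→ℚ-^ x (suc n) = trans (ℕ→ℚ-* x (x ℕ.^ n)) (cong (ℕ→ℚ x *_) (ℕ→ℚ-^ x n))

1/c*b≡1/a : ∀ a b c .{{_ : NonZero a}} .{{_ : NonZero b}} .{{_ : NonZero c}} → a ℕ.* b ≡ c →
            (+ 1) / c * ℕ→ℚ b ≡ (+ 1) / a
1/c*b≡1/a a@(suc _) b@(suc _) .(a ℕ.* b) refl =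
  trans (/-* (+ 1) (+ b) (a ℕ.* b) 1) (/-cross (+ 1 ℤ.* + b) (+ 1) (a ℕ.* b ℕ.* 1) a cross)
  where
  cross : (+ 1 ℤ.* + b) ℤ.* + a ≡ + 1 ℤ.* + (a ℕ.* b ℕ.* 1)
  cross = trans (cong (ℤ._* + a) (ZP.*-identityˡ (+ b)))
          (trans (sym (ZP.pos-* b a))
          (trans (cong +_ (trans (NP.*-comm b a) (sym (NP.*-identityʳ _)))) (sym (ZP.*-identityˡ _))))

1/a*a≡1 : ∀ a .{{_ : NonZero a}} → (+ 1) / a * ℕ→ℚ a ≡ 1ℚ
1/a*a≡1 a@(suc _) = trans (1/c*b≡1/a 1 a a (NP.*-identityˡ a)) refl

-1/a*a≡-1 : ∀ a .{{_ : NonZero a}} → (ℤ.- (+ 1)) / a * ℕ→ℚ a ≡ - 1ℚ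
-1/a*a≡-1 a@(suc _) = trans (/-* (ℤ.- (+ 1)) (+ a) a 1) (/-cross (ℤ.- (+ 1) ℤ.* + a) (ℤ.- (+ 1)) (a ℕ.* 1) 1 cross)
  where
  cross : (ℤ.- (+ 1) ℤ.* + a) ℤ.* + 1 ≡ ℤ.- (+ 1) ℤ.* + (a ℕ.* 1)
  cross = trans (ZP.*-identityʳ _) (cong (λ z → ℤ.- (+ 1) ℤ.* + z) (sym (NP.*-identityʳ a)))

invFact-suc : ∀ n → ℕ→ℚ (suc n) * invFact (suc n) ≡ invFact n
invFact-suc n = trans (QP.*-comm (ℕ→ℚ (suc n)) (invFact (suc n)))
  (1/c*b≡1/a (n ℕ.!) (suc n) (suc n ℕ.!) {{n NP.!≢0}} {{_}} {{suc n NP.!≢0}} (NP.*-comm (n ℕ.!) (suc n)))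

^ℚ-distrib-* : ∀ a b k → (a * b) ^ℚ k ≡ a ^ℚ k * b ^ℚ k
^ℚ-distrib-* a b zero = refl
^ℚ-distrib-* a b (suc k) = trans (cong ((a * b) *_) (^ℚ-distrib-* a b k))
  (solve 4 (λ a b x y → (a :* b) :* (x :* y) := (a :* x) :* (b :* y)) refl a b (a ^ℚ k) (b ^ℚ k))

sum-cong≤ : ∀ n {f g : ℕ → ℚ} → (∀ j → j ≤ n → f j ≡ g j) → sumTo n f ≡ sumTo n g
sum-cong≤ zero    f≡g = f≡g 0 z≤n
sum-cong≤ (suc n) f≡g = cong₂ _+_ (sum-cong≤ n (λ j j≤n → f≡g j (NP.m≤n⇒m≤1+n j≤n))) (f≡g (suc n) NP.≤-refl)

sum-cong : ∀ n {f g : ℕ → ℚ} → (∀ j → f j ≡ g j) → sumTo n f ≡ sumTo n g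
sum-cong n f≡g = sum-cong≤ n (λ j _ → f≡g j)

sum-+ : ∀ n (f g : ℕ → ℚ) → sumTo n (λ j → f j + g j) ≡ sumTo n f + sumTo n g
sum-+ zero f g = refl
sum-+ (suc n) f g = trans (cong (_+ (f (suc n) + g (suc n))) (sum-+ n f g))
  (solve 4 (λ a b c d → (a :+ b) :+ (c :+ d) := (a :+ c) :+ (b :+ d)) refl
     (sumTo n f) (sumTo n g) (f (suc n)) (g (suc n)))

sum-*ˡ : ∀ n c (f : ℕ → ℚ) → sumTo n (λ j → c * f j) ≡ c * sumTo n f
sum-*ˡ zero c f = refl
sum-*ˡ (suc n) c f = trans (cong (_+ (c * f (suc n))) (sum-*ˡ n c f))
  (sym (QP.*-distribˡ-+ c (sumTo n f) (f (suc n))))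

sum-head : ∀ n (f : ℕ → ℚ) → sumTo (suc n) f ≡ f 0 + sumTo n (λ j → f (suc j))
sum-head zero f = refl
sum-head (suc n) f = trans (cong (_+ f (suc (suc n))) (sum-head n f)) (QP.+-assoc (f 0) _ _)

sum-vanish : ∀ n (f : ℕ → ℚ) → (∀ j → j ≤ n → f j ≡ 0ℚ) → sumTo n f ≡ 0ℚ
sum-vanish zero    f f≡0 = f≡0 0 z≤n
sum-vanish (suc n) f f≡0 =
  trans (cong₂ _+_ (sum-vanish n f (λ j j≤n → f≡0 j (NP.m≤n⇒m≤1+n j≤n))) (f≡0 (suc n) NP.≤-refl)) refl

sum-extend : ∀ n N (f : ℕ → ℚ) → n ≤ N → (∀ j → n < j → f j ≡ 0ℚ) → sumTo N f ≡ sumTo n f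
sum-extend n N f n≤N f≡0 = trans (cong (λ z → sumTo z f) (sym (NP.m∸n+n≡m n≤N))) (pad (N ∸ n))
  where
  pad : ∀ k → sumTo (k ℕ.+ n) f ≡ sumTo n f
  pad zero = refl
  pad (suc k) = trans (cong (λ z → sumTo (k ℕ.+ n) f + z) (f≡0 (suc (k ℕ.+ n)) (s≤s (NP.m≤n+m n k))))
                      (trans (QP.+-identityʳ _) (pad k))

pascal-split : ∀ k (g : ℕ → ℚ) → sumTo (suc k) (λ j → ℕ→ℚ (suc k C j) * g j)
  ≡ sumTo k (λ j → ℕ→ℚ (k C j) * g j) + sumTo k (λ j → ℕ→ℚ (k C j) * g (suc j))
pascal-split k g =
  begin
    sumTo (suc k) (λ j → ℕ→ℚ (suc k C j) * g j)
  ≡⟨ sum-head k (λ j → ℕ→ℚ (suc k C j) * g j) ⟩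
    ℕ→ℚ 1 * g 0 + sumTo k (λ j → ℕ→ℚ (suc k C suc j) * g (suc j))
  ≡⟨ cong (λ z → ℕ→ℚ 1 * g 0 + z) (trans (sum-cong k pascal) (sum-+ k _ _)) ⟩
    ℕ→ℚ 1 * g 0 + (shifted + upper)
  ≡⟨ solve 3 (λ a b c → a :+ (b :+ c) := (a :+ c) :+ b) refl (ℕ→ℚ 1 * g 0) shifted upper ⟩
    (ℕ→ℚ 1 * g 0 + upper) + shifted
  ≡⟨ cong (_+ shifted) unshift ⟩
    sumTo k (λ j → ℕ→ℚ (k C j) * g j) + shifted
  ∎
  where
  open ≡-Reasoning
  shifted = sumTo k (λ j → ℕ→ℚ (k C j) * g (suc j))
  upper = sumTo k (λ j → ℕ→ℚ (k C suc j) * g (suc j))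
  pascal : ∀ j → ℕ→ℚ (suc k C suc j) * g (suc j) ≡ ℕ→ℚ (k C j) * g (suc j) + ℕ→ℚ (k C suc j) * g (suc j)
  pascal j = trans (cong (λ z → ℕ→ℚ z * g (suc j)) (sym (nCk+nC[k+1]≡[n+1]C[k+1] k j)))
             (trans (cong (_* g (suc j)) (ℕ→ℚ-+ (k C j) (k C suc j)))
                    (QP.*-distribʳ-+ (g (suc j)) (ℕ→ℚ (k C j)) (ℕ→ℚ (k C suc j))))
  -- the term with j = k+1 vanishes, since k C (k+1) = 0
  unshift : ℕ→ℚ 1 * g 0 + upper ≡ sumTo k (λ j → ℕ→ℚ (k C j) * g j)
  unshift = trans (sym (sum-head k (λ j → ℕ→ℚ (k C j) * g j)))
    (sum-extend k (suc k) _ (NP.n≤1+n k)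
      (λ j k<j → trans (cong (λ z → ℕ→ℚ z * g j) (k>n⇒nCk≡0 k<j)) (QP.*-zeroˡ (g j))))

binomial : ∀ n a b → (a + b) ^ℚ n ≡ sumTo n (λ l → ℕ→ℚ (n C l) * (a ^ℚ l * b ^ℚ (n ∸ l)))
binomial zero a b = solve 0 (con 1ℚ := con 1ℚ :* (con 1ℚ :* con 1ℚ)) refl
binomial (suc n) a b = sym (
  begin
    sumTo (suc n) (λ l → ℕ→ℚ (suc n C l) * (a ^ℚ l * b ^ℚ (suc n ∸ l)))
  ≡⟨ pascal-split n (λ l → a ^ℚ l * b ^ℚ (suc n ∸ l)) ⟩
    sumTo n (λ l → ℕ→ℚ (n C l) * (a ^ℚ l * b ^ℚ (suc n ∸ l)))
      + sumTo n (λ l → ℕ→ℚ (n C l) * (a ^ℚ suc l * b ^ℚ (n ∸ l)))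
  ≡⟨ cong₂ _+_ (trans (sum-cong≤ n bTerm) (sum-*ˡ n b _)) (trans (sum-cong n aTerm) (sum-*ˡ n a _)) ⟩
    b * X + a * X
  ≡⟨ solve 3 (λ a b X → b :* X :+ a :* X := (a :+ b) :* X) refl a b X ⟩
    (a + b) * X
  ≡⟨ cong ((a + b) *_) (sym (binomial n a b)) ⟩
    (a + b) ^ℚ suc n
  ∎)
  where
  open ≡-Reasoning
  X = sumTo n (λ l → ℕ→ℚ (n C l) * (a ^ℚ l * b ^ℚ (n ∸ l)))
  bTerm : ∀ l → l ≤ n → ℕ→ℚ (n C l) * (a ^ℚ l * b ^ℚ (suc n ∸ l)) ≡ b * (ℕ→ℚ (n C l) * (a ^ℚ l * b ^ℚ (n ∸ l)))
  bTerm l l≤n = trans (cong (λ z → ℕ→ℚ (n C l) * (a ^ℚ l * b ^ℚ z)) (NP.+-∸-assoc 1 l≤n))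
    (solve 4 (λ c x b y → c :* (x :* (b :* y)) := b :* (c :* (x :* y))) refl (ℕ→ℚ (n C l)) (a ^ℚ l) b (b ^ℚ (n ∸ l)))
  aTerm : ∀ l → ℕ→ℚ (n C l) * (a ^ℚ suc l * b ^ℚ (n ∸ l)) ≡ a * (ℕ→ℚ (n C l) * (a ^ℚ l * b ^ℚ (n ∸ l)))
  aTerm l = solve 4 (λ c a x y → c :* ((a :* x) :* y) := a :* (c :* (x :* y))) refl (ℕ→ℚ (n C l)) a (a ^ℚ l) (b ^ℚ (n ∸ l))

-- Formal power series (coefficient sequences, Defs.Series) under the Cauchy
-- product ⊛.  θ = z d/dz is the Euler operator, zShift is multiplication by z
-- and  ∂[ c ] = (1 + c z) d/dz;  both θ and ∂[ c ] are derivations.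

θ : Series → Series
θ f n = ℕ→ℚ n * f n

zShift : Series → Series
zShift f zero = 0ℚ
zShift f (suc n) = f n

∂[_] : ℚ → Series → Series
∂[ c ] f n = θ f (suc n) + c * θ f n

⊛-congʳ : ∀ (f : Series) {g h : Series} → (∀ j → g j ≡ h j) → ∀ n → (f ⊛ g) n ≡ (f ⊛ h) n
⊛-congʳ f g≡h n = sum-cong n (λ j → cong (f j *_) (g≡h (n ∸ j)))

⊛-congˡ : ∀ {f g : Series} (h : Series) → (∀ j → f j ≡ g j) → ∀ n → (f ⊛ h) n ≡ (g ⊛ h) n
⊛-congˡ h f≡g n = sum-cong n (λ j → cong (_* h (n ∸ j)) (f≡g j))

⊛-+ʳ : ∀ (f g h : Series) n → (f ⊛ (λ j → g j + h j)) n ≡ (f ⊛ g) n + (f ⊛ h) n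
⊛-+ʳ f g h n = trans (sum-cong n (λ j → QP.*-distribˡ-+ (f j) (g (n ∸ j)) (h (n ∸ j)))) (sum-+ n _ _)

⊛-+ˡ : ∀ (f g h : Series) n → ((λ j → f j + g j) ⊛ h) n ≡ (f ⊛ h) n + (g ⊛ h) n
⊛-+ˡ f g h n = trans (sum-cong n (λ j → QP.*-distribʳ-+ (h (n ∸ j)) (f j) (g j))) (sum-+ n _ _)

⊛-*ʳ : ∀ (f g : Series) c n → (f ⊛ (λ j → c * g j)) n ≡ c * (f ⊛ g) n
⊛-*ʳ f g c n = trans (sum-cong n (λ j → solve 3 (λ a b c → a :* (c :* b) := c :* (a :* b)) refl (f j) (g (n ∸ j)) c))
  (sum-*ˡ n c _)

⊛-*ˡ : ∀ (f g : Series) c n → ((λ j → c * f j) ⊛ g) n ≡ c * (f ⊛ g) n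
⊛-*ˡ f g c n = trans (sum-cong n (λ j → QP.*-assoc c (f j) (g (n ∸ j)))) (sum-*ˡ n c _)

one-⊛ : ∀ (g : Series) n → (one ⊛ g) n ≡ g n
one-⊛ g zero = QP.*-identityˡ (g 0)
one-⊛ g (suc n) = trans (sum-head n (λ j → one j * g (suc n ∸ j)))
  (trans (cong₂ _+_ (QP.*-identityˡ (g (suc n))) (sum-vanish n _ (λ j _ → QP.*-zeroˡ (g (suc n ∸ suc j)))))
         (QP.+-identityʳ _))

zShift-⊛ : ∀ (f g : Series) n → (zShift f ⊛ g) n ≡ zShift (f ⊛ g) n
zShift-⊛ f g zero = QP.*-zeroˡ (g 0)
zShift-⊛ f g (suc n) = trans (sum-head n (λ j → zShift f j * g (suc n ∸ j)))
  (trans (cong (_+ sumTo n (λ j → f j * g (n ∸ j))) (QP.*-zeroˡ (g (suc n)))) (QP.+-identityˡ _))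

⊛-vanish : ∀ (f g : Series) n → (∀ j → j ≤ n → g j ≡ 0ℚ) → (f ⊛ g) n ≡ 0ℚ
⊛-vanish f g n g≡0 = sum-vanish n _ (λ j _ → trans (cong (f j *_) (g≡0 (n ∸ j) (NP.m∸n≤m n j))) (QP.*-zeroʳ (f j)))

θ-leibniz : ∀ (f g : Series) n → θ (f ⊛ g) n ≡ (θ f ⊛ g) n + (f ⊛ θ g) n
θ-leibniz f g n = trans (sym (sum-*ˡ n (ℕ→ℚ n) _)) (trans (sum-cong≤ n split) (sum-+ n _ _))
  where
  -- n = j + (n - j) distributed over the j-th term
  split : ∀ j → j ≤ n → ℕ→ℚ n * (f j * g (n ∸ j)) ≡ θ f j * g (n ∸ j) + f j * θ g (n ∸ j)
  split j j≤n = trans (cong (λ z → z * (f j * g (n ∸ j))) (trans (cong ℕ→ℚ (sym (NP.m+[n∸m]≡n j≤n))) (ℕ→ℚ-+ j (n ∸ j))))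
    (solve 4 (λ a b x y → (a :+ b) :* (x :* y) := (a :* x) :* y :+ x :* (b :* y)) refl (ℕ→ℚ j) (ℕ→ℚ (n ∸ j)) (f j) (g (n ∸ j)))

-- At index n+1 the boundary term of θ f ⊛ g (j = 0) resp. f ⊛ θ g (j = n+1)
-- vanishes, because θ kills the constant coefficient.
θ⊛-suc : ∀ (f g : Series) n → (θ f ⊛ g) (suc n) ≡ sumTo n (λ j → θ f (suc j) * g (n ∸ j))
θ⊛-suc f g n = trans (sum-head n (λ j → θ f j * g (suc n ∸ j)))
  (trans (cong (_+ sumTo n (λ j → θ f (suc j) * g (n ∸ j)))
                (trans (cong (_* g (suc n)) (QP.*-zeroˡ (f 0))) (QP.*-zeroˡ (g (suc n)))))
         (QP.+-identityˡ _))

⊛θ-suc : ∀ (f g : Series) n → (f ⊛ θ g) (suc n) ≡ sumTo n (λ j → f j * θ g (suc (n ∸ j)))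
⊛θ-suc f g n = trans (cong₂ _+_ (sum-cong≤ n (λ j j≤n → cong (λ z → f j * θ g z) (NP.+-∸-assoc 1 j≤n)))
                                (trans (cong (λ z → f (suc n) * θ g z) (NP.n∸n≡0 (suc n)))
                                       (trans (cong (f (suc n) *_) (QP.*-zeroˡ (g 0))) (QP.*-zeroʳ (f (suc n))))))
                     (QP.+-identityʳ _)

∂-leibniz : ∀ c (f g : Series) n → ∂[ c ] (f ⊛ g) n ≡ (∂[ c ] f ⊛ g) n + (f ⊛ ∂[ c ] g) n
∂-leibniz c f g n =
  begin
    θ (f ⊛ g) (suc n) + c * θ (f ⊛ g) n
  ≡⟨ cong₂ (λ a b → a + c * b) (θ-leibniz f g (suc n)) (θ-leibniz f g n) ⟩
    ((θ f ⊛ g) (suc n) + (f ⊛ θ g) (suc n)) + c * (B1 + B2)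
  ≡⟨ cong₂ (λ a b → (a + b) + c * (B1 + B2)) (θ⊛-suc f g n) (⊛θ-suc f g n) ⟩
    (A1 + A2) + c * (B1 + B2)
  ≡⟨ solve 5 (λ A1 A2 B1 B2 c → (A1 :+ A2) :+ c :* (B1 :+ B2) := (A1 :+ c :* B1) :+ (A2 :+ c :* B2)) refl A1 A2 B1 B2 c ⟩
    (A1 + c * B1) + (A2 + c * B2)
  ≡⟨ cong₂ _+_ (trans (cong (λ z → A1 + z) (sym (sum-*ˡ n c _))) (sym (sum-+ n _ _)))
               (trans (cong (λ z → A2 + z) (sym (sum-*ˡ n c _))) (sym (sum-+ n _ _))) ⟩
    sumTo n (λ j → θ f (suc j) * g (n ∸ j) + c * (θ f j * g (n ∸ j)))
      + sumTo n (λ j → f j * θ g (suc (n ∸ j)) + c * (f j * θ g (n ∸ j)))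
  ≡⟨ cong₂ _+_
       (sum-cong n (λ j → solve 4 (λ a b x c → a :* x :+ c :* (b :* x) := (a :+ c :* b) :* x) refl
                                (θ f (suc j)) (θ f j) (g (n ∸ j)) c))
       (sum-cong n (λ j → solve 4 (λ a x y c → a :* x :+ c :* (a :* y) := a :* (x :+ c :* y)) refl
                                (f j) (θ g (suc (n ∸ j))) (θ g (n ∸ j)) c)) ⟩
    (∂[ c ] f ⊛ g) n + (f ⊛ ∂[ c ] g) n
  ∎
  where
  open ≡-Reasoning
  A1 = sumTo n (λ j → θ f (suc j) * g (n ∸ j))
  A2 = sumTo n (λ j → f j * θ g (suc (n ∸ j)))
  B1 = (θ f ⊛ g) n
  B2 = (f ⊛ θ g) n

-- The generating series of R:  R_{n,k}(t) = n! [z^n] e^{-tz} (1+mz)^{-1/m} L^k / (m^k k!)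
-- with L = ln(1+mz).  Applying ∂ = (1+mz) d/dz to the three factors gives
--     ∂ e^{-tz} = -t (1+mz) e^{-tz},   ∂ (1+mz)^{-1/m} = -(1+mz)^{-1/m},   ∂ L = m,
-- hence a first-order recurrence in n for R_{n,k}.
module GeneratingSeries (m : ℕ) .{{_ : NonZero m}} (t : ℚ) where

  M : ℚ
  M = ℕ→ℚ m

  ∂ₘ : Series → Series
  ∂ₘ = ∂[ M ]

  expS binS logS : Series
  expS = expNeg t
  binS = binomSeries m
  logS = logSeries m

  logPow : ℕ → Series
  logPow k = logS ^ˢ k

  binLog : ℕ → Series
  binLog k = binS ⊛ logPow k

  genR : ℕ → Series
  genR k = expS ⊛ binLog k

  exp-coeff-suc : ∀ n → ℕ→ℚ (suc n) * expS (suc n) ≡ - t * expS n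
  exp-coeff-suc n =
    trans (solve 4 (λ s x p i → s :* ((x :* p) :* i) := (x :* p) :* (s :* i)) refl
             (ℕ→ℚ (suc n)) (- t) ((- t) ^ℚ n) (invFact (suc n)))
    (trans (cong ((- t * ((- t) ^ℚ n)) *_) (invFact-suc n)) (QP.*-assoc (- t) _ _))

  θ-exp : ∀ n → θ expS n ≡ - t * zShift expS n
  θ-exp zero = trans (QP.*-zeroˡ (expS 0)) (sym (QP.*-zeroʳ (- t)))
  θ-exp (suc n) = exp-coeff-suc n

  ∂-exp : ∀ n → ∂ₘ expS n ≡ - t * (expS n + M * zShift expS n)
  ∂-exp n = trans (cong₂ (λ a c → a + M * c) (exp-coeff-suc n) (θ-exp n))
    (solve 4 (λ T a M z → T :* a :+ M :* (T :* z) := T :* (a :+ M :* z)) refl (- t) (expS n) M (zShift expS n))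

  bin-coeff-suc : ∀ n → ℕ→ℚ (suc n) * binS (suc n) ≡ - (1ℚ + M * ℕ→ℚ n) * binS n
  bin-coeff-suc n =
    begin
      ℕ→ℚ (suc n) * (((pr * c) * invFact (suc n)) * (M * Mn))
    ≡⟨ solve 6 (λ s pr c i M Mn → s :* (((pr :* c) :* i) :* (M :* Mn)) := ((pr :* (s :* i)) :* Mn) :* (c :* M)) refl
         (ℕ→ℚ (suc n)) pr c (invFact (suc n)) M Mn ⟩
      ((pr * (ℕ→ℚ (suc n) * invFact (suc n))) * Mn) * (c * M)
    ≡⟨ cong₂ (λ u v → ((pr * u) * Mn) * v) (invFact-suc n) cM ⟩
      ((pr * invFact n) * Mn) * ((- 1ℚ) - M * ℕ→ℚ n)
    ≡⟨ solve 4 (λ X Mn M k → X :* Mn :* (:- con 1ℚ :- M :* k) := :- (con 1ℚ :+ M :* k) :* (X :* Mn)) refl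
         (pr * invFact n) Mn M (ℕ→ℚ n) ⟩
      - (1ℚ + M * ℕ→ℚ n) * binS n
    ∎
    where
    open ≡-Reasoning
    pr = prodBelow n (λ j → (ℤ.- (+ 1)) / m - ℕ→ℚ j)
    c = (ℤ.- (+ 1)) / m - ℕ→ℚ n
    Mn = M ^ℚ n
    cM : c * M ≡ (- 1ℚ) - M * ℕ→ℚ n
    cM = trans (QP.*-distribʳ-+ M ((ℤ.- (+ 1)) / m) (- ℕ→ℚ n))
         (cong₂ _+_ (-1/a*a≡-1 m) (solve 2 (λ k M → (:- k) :* M := :- (M :* k)) refl (ℕ→ℚ n) M))

  ∂-bin : ∀ n → ∂ₘ binS n ≡ (- 1ℚ) * binS n
  ∂-bin n = trans (cong (_+ M * θ binS n) (bin-coeff-suc n))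
    (solve 3 (λ M k x → :- (con 1ℚ :+ M :* k) :* x :+ M :* (k :* x) := (:- con 1ℚ) :* x) refl M (ℕ→ℚ n) (binS n))

  ∂-log : ∀ n → ∂ₘ logS n ≡ M * one n
  ∂-log zero = solve 1 (λ M → con 1ℚ :* (con 1ℚ :* (M :* con 1ℚ) :* con 1ℚ) :+ M :* (con 0ℚ :* con 0ℚ) := M :* con 1ℚ) refl M
  ∂-log (suc n) =
    begin
      ℕ→ℚ (suc (suc n)) * ((s' * (M * (M * Mn))) * u2) + M * (ℕ→ℚ (suc n) * ((s * (M * Mn)) * u1))
    ≡⟨ solve 8 (λ a2 s' M Mn u2 a1 s u1 → a2 :* ((s' :* (M :* (M :* Mn))) :* u2) :+ M :* (a1 :* ((s :* (M :* Mn)) :* u1))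
                   := (s' :* (M :* (M :* Mn))) :* (u2 :* a2) :+ M :* ((s :* (M :* Mn)) :* (u1 :* a1))) refl
         (ℕ→ℚ (suc (suc n))) s' M Mn u2 (ℕ→ℚ (suc n)) s u1 ⟩
      (s' * (M * (M * Mn))) * (u2 * ℕ→ℚ (suc (suc n))) + M * ((s * (M * Mn)) * (u1 * ℕ→ℚ (suc n)))
    ≡⟨ cong₂ (λ x y → (s' * (M * (M * Mn))) * x + M * ((s * (M * Mn)) * y)) (1/a*a≡1 (suc (suc n))) (1/a*a≡1 (suc n)) ⟩
      ((- 1ℚ) * s * (M * (M * Mn))) * 1ℚ + M * ((s * (M * Mn)) * 1ℚ)
    ≡⟨ solve 3 (λ s M Mn → ((:- con 1ℚ) :* s :* (M :* (M :* Mn))) :* con 1ℚ :+ M :* ((s :* (M :* Mn)) :* con 1ℚ) := M :* con 0ℚ)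
         refl s M Mn ⟩
      M * 0ℚ
    ∎
    where
    open ≡-Reasoning
    s = (- 1ℚ) ^ℚ n
    s' = (- 1ℚ) ^ℚ suc n
    Mn = M ^ℚ n
    u1 = (+ 1) / suc n
    u2 = (+ 1) / suc (suc n)

  ∂-one : ∀ n → ∂ₘ one n ≡ 0ℚ
  ∂-one zero = solve 1 (λ M → con 1ℚ :* con 0ℚ :+ M :* (con 0ℚ :* con 1ℚ) := con 0ℚ) refl M
  ∂-one (suc n) = solve 3 (λ a M c → a :* con 0ℚ :+ M :* (c :* con 0ℚ) := con 0ℚ) refl (ℕ→ℚ (suc (suc n))) M (ℕ→ℚ (suc n))

  ∂-logPow : ∀ k n → ∂ₘ (logPow k) n ≡ ℕ→ℚ k * M * logPow (ℕ.pred k) n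
  ∂-logPow zero n = trans (∂-one n) (sym (trans (cong (_* one n) (QP.*-zeroˡ M)) (QP.*-zeroˡ (one n))))
  ∂-logPow (suc k) n =
    begin
      ∂ₘ (logS ⊛ logPow k) n
    ≡⟨ ∂-leibniz M logS (logPow k) n ⟩
      (∂ₘ logS ⊛ logPow k) n + (logS ⊛ ∂ₘ (logPow k)) n
    ≡⟨ cong₂ _+_ (trans (⊛-congˡ (logPow k) ∂-log n) (trans (⊛-*ˡ one (logPow k) M n) (cong (M *_) (one-⊛ (logPow k) n))))
                 (trans (⊛-congʳ logS (∂-logPow k) n) (trans (⊛-*ʳ logS (logPow (ℕ.pred k)) (ℕ→ℚ k * M) n) (lower k))) ⟩
      M * logPow k n + ℕ→ℚ k * M * logPow k n
    ≡⟨ solve 3 (λ M x a → M :* x :+ a :* M :* x := (con 1ℚ :+ a) :* M :* x) refl M (logPow k n) (ℕ→ℚ k) ⟩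
      (1ℚ + ℕ→ℚ k) * M * logPow k n
    ≡⟨ cong (λ z → z * M * logPow k n) (sym (ℕ→ℚ-+ 1 k)) ⟩
      ℕ→ℚ (suc k) * M * logPow k n
    ∎
    where
    open ≡-Reasoning
    -- L · L^{k-1} = L^k, except for k = 0 where the factor k kills the term
    lower : ∀ k → ℕ→ℚ k * M * (logS ⊛ logPow (ℕ.pred k)) n ≡ ℕ→ℚ k * M * logPow k n
    lower zero = trans (cong (_* (logS ⊛ one) n) (QP.*-zeroˡ M))
                 (trans (QP.*-zeroˡ ((logS ⊛ one) n)) (sym (trans (cong (_* one n) (QP.*-zeroˡ M)) (QP.*-zeroˡ (one n)))))
    lower (suc k) = refl

  ∂-binLog : ∀ k n → ∂ₘ (binLog k) n ≡ (- 1ℚ) * binLog k n + ℕ→ℚ k * M * binLog (ℕ.pred k) n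
  ∂-binLog k n = trans (∂-leibniz M binS (logPow k) n)
    (cong₂ _+_ (trans (⊛-congˡ (logPow k) ∂-bin n) (⊛-*ˡ binS (logPow k) (- 1ℚ) n))
               (trans (⊛-congʳ binS (∂-logPow k) n) (⊛-*ʳ binS (logPow (ℕ.pred k)) (ℕ→ℚ k * M) n)))

  ∂-exp⊛ : ∀ (X : Series) n → (∂ₘ expS ⊛ X) n ≡ - t * ((expS ⊛ X) n + M * zShift (expS ⊛ X) n)
  ∂-exp⊛ X n =
    begin
      (∂ₘ expS ⊛ X) n
    ≡⟨ trans (⊛-congˡ X ∂-exp n) (⊛-*ˡ _ X (- t) n) ⟩
      - t * ((λ j → expS j + M * zShift expS j) ⊛ X) n
    ≡⟨ cong (- t *_) (trans (⊛-+ˡ expS _ X n)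
         (cong (λ z → (expS ⊛ X) n + z) (trans (⊛-*ˡ (zShift expS) X M n) (cong (M *_) (zShift-⊛ expS X n))))) ⟩
      - t * ((expS ⊛ X) n + M * zShift (expS ⊛ X) n)
    ∎
    where open ≡-Reasoning

  ∂-genR : ∀ k n → ∂ₘ (genR k) n
                  ≡ - t * (genR k n + M * zShift (genR k) n) + ((- 1ℚ) * genR k n + ℕ→ℚ k * M * genR (ℕ.pred k) n)
  ∂-genR k n = trans (∂-leibniz M expS (binLog k) n)
    (cong₂ _+_ (∂-exp⊛ (binLog k) n)
      (trans (⊛-congʳ expS (∂-binLog k) n)
      (trans (⊛-+ʳ expS (λ j → (- 1ℚ) * binLog k j) (λ j → ℕ→ℚ k * M * binLog (ℕ.pred k) j) n)
        (cong₂ _+_ (⊛-*ʳ expS (binLog k) (- 1ℚ) n) (⊛-*ʳ expS (binLog (ℕ.pred k)) (ℕ→ℚ k * M) n)))))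

  logPow-vanish : ∀ k n → n < k → logPow k n ≡ 0ℚ
  logPow-vanish (suc k) n n<k = sum-vanish n _ (λ j j≤n → term n j n<k j≤n)
    where
    term : ∀ n j → n < suc k → j ≤ n → logS j * logPow k (n ∸ j) ≡ 0ℚ
    term n zero _ _ = QP.*-zeroˡ (logPow k n)
    term (suc n') (suc j) (s≤s n'<k) (s≤s _) =
      trans (cong (logS (suc j) *_) (logPow-vanish k (n' ∸ j) (NP.≤-<-trans (NP.m∸n≤m n' j) n'<k)))
            (QP.*-zeroʳ (logS (suc j)))

  genR-vanish : ∀ k n → n < k → genR k n ≡ 0ℚ
  genR-vanish k n n<k = ⊛-vanish expS (binLog k) n
    (λ j j≤n → ⊛-vanish binS (logPow k) j (λ i i≤j → logPow-vanish k i (NP.≤-<-trans i≤j (NP.≤-<-trans j≤n n<k))))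

  ip : ℕ → ℚ
  ip k = invPowFact m k

  ip-suc : ∀ k → ip (suc k) * (ℕ→ℚ (suc k) * M) ≡ ip k
  ip-suc k = trans (cong (ip (suc k) *_) (sym (ℕ→ℚ-* (suc k) m)))
    (1/c*b≡1/a (m ℕ.^ k ℕ.* k ℕ.!) (suc k ℕ.* m) (m ℕ.^ suc k ℕ.* suc k ℕ.!)
       {{NP.m*n≢0 (m ℕ.^ k) (k ℕ.!) {{NP.m^n≢0 m k}} {{k NP.!≢0}}}} {{NP.m*n≢0 (suc k) m}}
       {{NP.m*n≢0 (m ℕ.^ suc k) (suc k ℕ.!) {{NP.m^n≢0 m (suc k)}} {{suc k NP.!≢0}}}} denominators)
    where
    open NS.+-*-Solver using () renaming (solve to solveℕ; _:*_ to _⊗_; _:=_ to _≐_)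
    denominators : m ℕ.^ k ℕ.* k ℕ.! ℕ.* (suc k ℕ.* m) ≡ m ℕ.^ suc k ℕ.* suc k ℕ.!
    denominators = solveℕ 4 (λ a f s m → (a ⊗ f) ⊗ (s ⊗ m) ≐ (m ⊗ a) ⊗ (s ⊗ f)) refl (m ℕ.^ k) (k ℕ.!) (suc k) m

  Rt : ℕ → ℕ → ℚ
  Rt n k = R m n k t

  -- n R_{n-1,k}, and 0 for n = 0: the coefficients coming from z·G_k
  Rshift : ℕ → ℕ → ℚ
  Rshift zero k = 0ℚ
  Rshift (suc n) k = ℕ→ℚ (suc n) * Rt n k

  Rprev : ℕ → ℕ → ℚ
  Rprev n zero = 0ℚ
  Rprev n (suc k) = Rt n k

  Rshift-coeff : ∀ n k → ℕ→ℚ (n ℕ.!) * (zShift (genR k) n * ip k) ≡ Rshift n k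
  Rshift-coeff zero k = trans (cong (ℕ→ℚ 1 *_) (QP.*-zeroˡ (ip k))) (QP.*-zeroʳ (ℕ→ℚ 1))
  Rshift-coeff (suc n) k = trans (cong (_* (genR k n * ip k)) (ℕ→ℚ-* (suc n) (n ℕ.!)))
    (QP.*-assoc (ℕ→ℚ (suc n)) (ℕ→ℚ (n ℕ.!)) _)

  Rprev-coeff : ∀ n k → ℕ→ℚ (n ℕ.!) * (genR (ℕ.pred k) n * (ip k * (ℕ→ℚ k * M))) ≡ Rprev n k
  Rprev-coeff n zero = solve 4 (λ a G i M → a :* (G :* (i :* (con 0ℚ :* M))) := con 0ℚ) refl
    (ℕ→ℚ (n ℕ.!)) (genR 0 n) (ip 0) M
  Rprev-coeff n (suc k) = cong (λ z → ℕ→ℚ (n ℕ.!) * (genR k n * z)) (ip-suc k)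

  -- (n+1)! [z^{n+1}] G = n! [z^n] (∂G - m θG)
  R-suc : ∀ n k → Rt (suc n) k ≡ ℕ→ℚ (n ℕ.!) * ((∂ₘ (genR k) n - M * (ℕ→ℚ n * genR k n)) * ip k)
  R-suc n k =
    trans (cong (_* (genR k (suc n) * ip k)) (ℕ→ℚ-* (suc n) (n ℕ.!)))
    (solve 6 (λ s nf a M n2 i → (s :* nf) :* (a :* i) := nf :* (((s :* a :+ M :* n2) :- M :* n2) :* i)) refl
       (ℕ→ℚ (suc n)) (ℕ→ℚ (n ℕ.!)) (genR k (suc n)) M (ℕ→ℚ n * genR k n) (ip k))

  R-rec : ∀ n k → Rt (suc n) k ≡ - (t + 1ℚ + M * ℕ→ℚ n) * Rt n k - t * M * Rshift n k + Rprev n k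
  R-rec n k =
    begin
      Rt (suc n) k
    ≡⟨ R-suc n k ⟩
      nf * ((∂ₘ (genR k) n - M * (ℕ→ℚ n * G)) * ip k)
    ≡⟨ cong (λ z → nf * ((z - M * (ℕ→ℚ n * G)) * ip k)) (∂-genR k n) ⟩
      nf * (((- t * (G + M * Z) + ((- 1ℚ) * G + ℕ→ℚ k * M * G′)) - M * (ℕ→ℚ n * G)) * ip k)
    ≡⟨ solve 9 (λ nf T G M Z κ G′ n i →
          nf :* ((((:- T) :* (G :+ M :* Z) :+ ((:- con 1ℚ) :* G :+ κ :* M :* G′)) :- M :* (n :* G)) :* i)
          := (:- (T :+ con 1ℚ :+ M :* n)) :* (nf :* (G :* i)) :- T :* M :* (nf :* (Z :* i)) :+ nf :* (G′ :* (i :* (κ :* M))))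
          refl nf t G M Z (ℕ→ℚ k) G′ (ℕ→ℚ n) (ip k) ⟩
      - (t + 1ℚ + M * ℕ→ℚ n) * Rt n k - t * M * (nf * (Z * ip k)) + nf * (G′ * (ip k * (ℕ→ℚ k * M)))
    ≡⟨ cong₂ (λ u v → - (t + 1ℚ + M * ℕ→ℚ n) * Rt n k - t * M * u + v) (Rshift-coeff n k) (Rprev-coeff n k) ⟩
      - (t + 1ℚ + M * ℕ→ℚ n) * Rt n k - t * M * Rshift n k + Rprev n k
    ∎
    where
    open ≡-Reasoning
    nf = ℕ→ℚ (n ℕ.!)
    G = genR k n
    Z = zShift (genR k) n
    G′ = genR (ℕ.pred k) n

  R-vanish : ∀ n k → n < k → Rt n k ≡ 0ℚ
  R-vanish n k n<k = trans (cong (λ z → ℕ→ℚ (n ℕ.!) * (z * ip k)) (genR-vanish k n n<k))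
    (trans (cong (ℕ→ℚ (n ℕ.!) *_) (QP.*-zeroˡ (ip k))) (QP.*-zeroʳ (ℕ→ℚ (n ℕ.!))))

  Rshift-vanish : ∀ n k → n < k → Rshift n k ≡ 0ℚ
  Rshift-vanish zero k _ = refl
  Rshift-vanish (suc n) k n<k =
    trans (cong (ℕ→ℚ (suc n) *_) (R-vanish n k (NP.<-trans (NP.n<1+n n) n<k))) (QP.*-zeroʳ (ℕ→ℚ (suc n)))

-- Forward differences at 0:  Δ₀ k f = (Δ^k f)(0)  with  (Δf)(y) = f(y+1) - f(y).

Δ₀ : ℕ → (ℕ → ℚ) → ℚ
Δ₀ zero f = f 0
Δ₀ (suc k) f = Δ₀ k (λ j → f (suc j)) - Δ₀ k f

Δ₀-cong : ∀ k {f g : ℕ → ℚ} → (∀ j → f j ≡ g j) → Δ₀ k f ≡ Δ₀ k g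
Δ₀-cong zero f≡g = f≡g 0
Δ₀-cong (suc k) f≡g = cong₂ _-_ (Δ₀-cong k (λ j → f≡g (suc j))) (Δ₀-cong k f≡g)

Δ₀-+ : ∀ k (f g : ℕ → ℚ) → Δ₀ k (λ j → f j + g j) ≡ Δ₀ k f + Δ₀ k g
Δ₀-+ zero f g = refl
Δ₀-+ (suc k) f g = trans (cong₂ _-_ (Δ₀-+ k (λ j → f (suc j)) (λ j → g (suc j))) (Δ₀-+ k f g))
  (solve 4 (λ a b c d → (a :+ b) :- (c :+ d) := (a :- c) :+ (b :- d)) refl
     (Δ₀ k (λ j → f (suc j))) (Δ₀ k (λ j → g (suc j))) (Δ₀ k f) (Δ₀ k g))

Δ₀-* : ∀ k c (f : ℕ → ℚ) → Δ₀ k (λ j → c * f j) ≡ c * Δ₀ k f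
Δ₀-* zero c f = refl
Δ₀-* (suc k) c f = trans (cong₂ _-_ (Δ₀-* k c (λ j → f (suc j))) (Δ₀-* k c f))
  (solve 3 (λ c a b → c :* a :- c :* b := c :* (a :- b)) refl c (Δ₀ k (λ j → f (suc j))) (Δ₀ k f))

Δ₀-neg : ∀ k (f : ℕ → ℚ) → Δ₀ k (λ j → - f j) ≡ - Δ₀ k f
Δ₀-neg zero f = refl
Δ₀-neg (suc k) f = trans (cong₂ _-_ (Δ₀-neg k (λ j → f (suc j))) (Δ₀-neg k f))
  (solve 2 (λ a b → (:- a) :- (:- b) := :- (a :- b)) refl (Δ₀ k (λ j → f (suc j))) (Δ₀ k f))

Δ₀-- : ∀ k (f g : ℕ → ℚ) → Δ₀ k (λ j → f j - g j) ≡ Δ₀ k f - Δ₀ k g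
Δ₀-- k f g = trans (Δ₀-+ k f (λ j → - g j)) (cong (λ z → Δ₀ k f + z) (Δ₀-neg k g))

Δ₀-zero : ∀ k → Δ₀ k (λ _ → 0ℚ) ≡ 0ℚ
Δ₀-zero zero = refl
Δ₀-zero (suc k) = trans (cong₂ _-_ (Δ₀-zero k) (Δ₀-zero k)) refl

Δ₀-const : ∀ k c → Δ₀ (suc k) (λ _ → c) ≡ 0ℚ
Δ₀-const k c = QP.+-inverseʳ (Δ₀ k (λ _ → c))

Δ₀-sum : ∀ n k (G : ℕ → ℕ → ℚ) → Δ₀ k (λ j → sumTo n (λ i → G i j)) ≡ sumTo n (λ i → Δ₀ k (G i))
Δ₀-sum zero k G = refl
Δ₀-sum (suc n) k G = trans (Δ₀-+ k (λ j → sumTo n (λ i → G i j)) (G (suc n))) (cong (_+ Δ₀ k (G (suc n))) (Δ₀-sum n k G))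

Δ₀-comm : ∀ n k (G : ℕ → ℕ → ℚ) → Δ₀ k (λ y → Δ₀ n (G y)) ≡ Δ₀ n (λ j → Δ₀ k (λ y → G y j))
Δ₀-comm zero k G = refl
Δ₀-comm (suc n) k G = trans (Δ₀-- k (λ y → Δ₀ n (λ j → G y (suc j))) (λ y → Δ₀ n (G y)))
  (cong₂ _-_ (Δ₀-comm n k (λ y j → G y (suc j))) (Δ₀-comm n k G))

Δ₀-shift : ∀ k f → Δ₀ k (λ j → f (suc j)) ≡ Δ₀ (suc k) f + Δ₀ k f
Δ₀-shift k f = solve 2 (λ a b → a := (a :- b) :+ b) refl (Δ₀ k (λ j → f (suc j))) (Δ₀ k f)

Δ₀-mulIndex : ∀ k (f : ℕ → ℚ) → Δ₀ (suc k) (λ j → ℕ→ℚ j * f j) ≡ ℕ→ℚ (suc k) * Δ₀ k (λ j → f (suc j))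
Δ₀-mulIndex zero f = trans (cong (λ z → ℕ→ℚ 1 * f 1 - z) (QP.*-zeroˡ (f 0))) (QP.+-identityʳ (ℕ→ℚ 1 * f 1))
Δ₀-mulIndex (suc k) f =
  begin
    Δ₀ (suc k) (λ j → ℕ→ℚ (suc j) * f (suc j)) - Δ₀ (suc k) (λ j → ℕ→ℚ j * f j)
  ≡⟨ cong (_- Δ₀ (suc k) (λ j → ℕ→ℚ j * f j)) (trans (Δ₀-cong (suc k) succ-split) (Δ₀-+ (suc k) _ _)) ⟩
    (Δ₀ (suc k) (λ j → 1ℚ * f (suc j)) + Δ₀ (suc k) (λ j → ℕ→ℚ j * f (suc j))) - Δ₀ (suc k) (λ j → ℕ→ℚ j * f j)
  ≡⟨ cong₂ (λ a b → (a + b) - Δ₀ (suc k) (λ j → ℕ→ℚ j * f j))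
       (Δ₀-cong (suc k) (λ j → QP.*-identityˡ (f (suc j)))) (Δ₀-mulIndex k (λ j → f (suc j))) ⟩
    (X + ℕ→ℚ (suc k) * Δ₀ k (λ j → f (suc (suc j)))) - Δ₀ (suc k) (λ j → ℕ→ℚ j * f j)
  ≡⟨ cong (λ z → (X + ℕ→ℚ (suc k) * Δ₀ k (λ j → f (suc (suc j)))) - z) (Δ₀-mulIndex k f) ⟩
    (X + ℕ→ℚ (suc k) * Δ₀ k (λ j → f (suc (suc j)))) - ℕ→ℚ (suc k) * Δ₀ k (λ j → f (suc j))
  ≡⟨ solve 4 (λ X s a b → (X :+ s :* a) :- s :* b := X :+ s :* (a :- b)) refl
       X (ℕ→ℚ (suc k)) (Δ₀ k (λ j → f (suc (suc j)))) (Δ₀ k (λ j → f (suc j))) ⟩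
    X + ℕ→ℚ (suc k) * X
  ≡⟨ solve 2 (λ X s → X :+ s :* X := (con 1ℚ :+ s) :* X) refl X (ℕ→ℚ (suc k)) ⟩
    (1ℚ + ℕ→ℚ (suc k)) * X
  ≡⟨ cong (_* X) (sym (ℕ→ℚ-+ 1 (suc k))) ⟩
    ℕ→ℚ (suc (suc k)) * X
  ∎
  where
  open ≡-Reasoning
  X = Δ₀ (suc k) (λ j → f (suc j))
  succ-split : ∀ j → ℕ→ℚ (suc j) * f (suc j) ≡ 1ℚ * f (suc j) + ℕ→ℚ j * f (suc j)
  succ-split j = trans (cong (_* f (suc j)) (ℕ→ℚ-+ 1 j)) (QP.*-distribʳ-+ (f (suc j)) 1ℚ (ℕ→ℚ j))

Δ₀-binomial : ∀ k f → Δ₀ k f ≡ sumTo k (λ j → ℕ→ℚ (k C j) * ((- 1ℚ) ^ℚ (k ∸ j)) * f j)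
Δ₀-binomial zero f = solve 1 (λ x → x := con 1ℚ :* con 1ℚ :* x) refl (f 0)
Δ₀-binomial (suc k) f = sym (
  begin
    sumTo (suc k) (λ j → ℕ→ℚ (suc k C j) * sgn (suc k) j * f j)
  ≡⟨ sum-cong (suc k) (λ j → QP.*-assoc (ℕ→ℚ (suc k C j)) _ _) ⟩
    sumTo (suc k) (λ j → ℕ→ℚ (suc k C j) * (sgn (suc k) j * f j))
  ≡⟨ pascal-split k (λ j → sgn (suc k) j * f j) ⟩
    sumTo k (λ j → ℕ→ℚ (k C j) * (sgn (suc k) j * f j)) + sumTo k (λ j → ℕ→ℚ (k C j) * (sgn k j * f (suc j)))
  ≡⟨ cong₂ _+_ (trans (sum-cong≤ k lowerTerm) (trans (sum-*ˡ k (- 1ℚ) _) (cong ((- 1ℚ) *_) (sym (Δ₀-binomial k f)))))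
               (trans (sum-cong k (λ j → sym (QP.*-assoc (ℕ→ℚ (k C j)) _ _))) (sym (Δ₀-binomial k (λ j → f (suc j))))) ⟩
    (- 1ℚ) * Δ₀ k f + Δ₀ k (λ j → f (suc j))
  ≡⟨ solve 2 (λ a b → con (- 1ℚ) :* a :+ b := b :- a) refl (Δ₀ k f) (Δ₀ k (λ j → f (suc j))) ⟩
    Δ₀ (suc k) f
  ∎)
  where
  open ≡-Reasoning
  sgn : ℕ → ℕ → ℚ
  sgn k j = (- 1ℚ) ^ℚ (k ∸ j)
  lowerTerm : ∀ j → j ≤ k → ℕ→ℚ (k C j) * (sgn (suc k) j * f j) ≡ (- 1ℚ) * (ℕ→ℚ (k C j) * sgn k j * f j)
  lowerTerm j j≤k = trans (cong (λ z → ℕ→ℚ (k C j) * ((- 1ℚ) ^ℚ z * f j)) (NP.+-∸-assoc 1 j≤k))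
    (solve 3 (λ c s x → c :* ((con (- 1ℚ) :* s) :* x) := con (- 1ℚ) :* (c :* s :* x)) refl (ℕ→ℚ (k C j)) (sgn k j) (f j))

S-vanish : ∀ r n → r < n → S r n ≡ 0
S-vanish zero (suc n) _ = refl
S-vanish (suc r) (suc n) (s≤s r<n) =
  cong₂ ℕ._+_ (trans (cong (suc n ℕ.*_) (S-vanish r (suc n) (NP.m<n⇒m<1+n r<n))) (NP.*-zeroʳ (suc n))) (S-vanish r n r<n)

S-diag : ∀ n → S n n ≡ 1
S-diag zero = refl
S-diag (suc n) = cong₂ ℕ._+_ (trans (cong (suc n ℕ.*_) (S-vanish n (suc n) (NP.n<1+n n))) (NP.*-zeroʳ (suc n))) (S-diag n)

Δ₀-power : ∀ r n → Δ₀ n (λ j → ℕ→ℚ (j ℕ.^ r)) ≡ ℕ→ℚ (n ℕ.!) * ℕ→ℚ (S r n)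
Δ₀-power zero zero = refl
Δ₀-power zero (suc n) = trans (Δ₀-const n (ℕ→ℚ 1)) (sym (QP.*-zeroʳ (ℕ→ℚ (suc n ℕ.!))))
Δ₀-power (suc r) zero = sym (QP.*-zeroʳ (ℕ→ℚ 1))
Δ₀-power (suc r) (suc n) =
  begin
    Δ₀ (suc n) (λ j → ℕ→ℚ (j ℕ.* j ℕ.^ r))
  ≡⟨ Δ₀-cong (suc n) (λ j → ℕ→ℚ-* j (j ℕ.^ r)) ⟩
    Δ₀ (suc n) (λ j → ℕ→ℚ j * ℕ→ℚ (j ℕ.^ r))
  ≡⟨ Δ₀-mulIndex n (λ j → ℕ→ℚ (j ℕ.^ r)) ⟩
    s * Δ₀ n (λ j → ℕ→ℚ (suc j ℕ.^ r))
  ≡⟨ cong (s *_) (Δ₀-shift n (λ j → ℕ→ℚ (j ℕ.^ r))) ⟩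
    s * (Δ₀ (suc n) (λ j → ℕ→ℚ (j ℕ.^ r)) + Δ₀ n (λ j → ℕ→ℚ (j ℕ.^ r)))
  ≡⟨ cong₂ (λ u v → s * (u + v)) (Δ₀-power r (suc n)) (Δ₀-power r n) ⟩
    s * (ℕ→ℚ (suc n ℕ.* n ℕ.!) * a + nf * b)
  ≡⟨ cong (λ z → s * (z * a + nf * b)) (ℕ→ℚ-* (suc n) (n ℕ.!)) ⟩
    s * ((s * nf) * a + nf * b)
  ≡⟨ solve 4 (λ s nf a b → s :* ((s :* nf) :* a :+ nf :* b) := (s :* nf) :* (s :* a :+ b)) refl s nf a b ⟩
    (s * nf) * (s * a + b)
  ≡⟨ sym (cong₂ _*_ (ℕ→ℚ-* (suc n) (n ℕ.!))
                    (trans (ℕ→ℚ-+ (suc n ℕ.* S r (suc n)) (S r n)) (cong (_+ b) (ℕ→ℚ-* (suc n) (S r (suc n)))))) ⟩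
    ℕ→ℚ (suc n ℕ.!) * ℕ→ℚ (S (suc r) (suc n))
  ∎
  where
  open ≡-Reasoning
  s = ℕ→ℚ (suc n)
  nf = ℕ→ℚ (n ℕ.!)
  a = ℕ→ℚ (S r (suc n))
  b = ℕ→ℚ (S r n)

-- Polynomial functions ℕ → ℚ, characterised by Newton's criterion: g has
-- degree ≤ d when all its differences of order > d vanish at 0.
DegreeAtMost : ℕ → (ℕ → ℚ) → Set
DegreeAtMost d g = ∀ k → d < k → Δ₀ k g ≡ 0ℚ

deg-cong : ∀ {d f g} → (∀ y → f y ≡ g y) → DegreeAtMost d f → DegreeAtMost d g
deg-cong f≡g Df k d<k = trans (sym (Δ₀-cong k f≡g)) (Df k d<k)

deg-+ : ∀ {d f g} → DegreeAtMost d f → DegreeAtMost d g → DegreeAtMost d (λ y → f y + g y)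
deg-+ {f = f} {g} Df Dg k d<k = trans (Δ₀-+ k f g) (cong₂ _+_ (Df k d<k) (Dg k d<k))

deg-* : ∀ {d f} c → DegreeAtMost d f → DegreeAtMost d (λ y → c * f y)
deg-* {f = f} c Df k d<k = trans (Δ₀-* k c f) (trans (cong (c *_) (Df k d<k)) (QP.*-zeroʳ c))

deg-mono : ∀ {d d′ f} → d ≤ d′ → DegreeAtMost d f → DegreeAtMost d′ f
deg-mono d≤d′ Df k d′<k = Df k (NP.≤-<-trans d≤d′ d′<k)

deg-const : ∀ c → DegreeAtMost 0 (λ _ → c)
deg-const c (suc k) _ = Δ₀-const k c

deg-suc : ∀ {d f} → DegreeAtMost d f → DegreeAtMost d (λ y → f (suc y))
deg-suc {f = f} Df k d<k = trans (Δ₀-shift k f) (cong₂ _+_ (Df (suc k) (NP.m<n⇒m<1+n d<k)) (Df k d<k))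

deg-translate : ∀ {d f} → DegreeAtMost d f → ∀ j → DegreeAtMost d (λ y → f (y ℕ.+ j))
deg-translate {f = f} Df zero = deg-cong (λ y → cong f (sym (NP.+-identityʳ y))) Df
deg-translate {f = f} Df (suc j) = deg-cong (λ y → cong f (sym (NP.+-suc y j))) (deg-suc (deg-translate Df j))

deg-mulIndex : ∀ {d f} → DegreeAtMost d f → DegreeAtMost (suc d) (λ y → ℕ→ℚ y * f y)
deg-mulIndex {f = f} Df (suc k) (s≤s d<k) =
  trans (Δ₀-mulIndex k f) (trans (cong (ℕ→ℚ (suc k) *_) (deg-suc Df k d<k)) (QP.*-zeroʳ (ℕ→ℚ (suc k))))

diff : ℕ → (ℕ → ℚ) → ℕ → ℚ
diff n g y = Δ₀ n (λ j → g (y ℕ.+ j))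

deg-diff : ∀ {d g} n → DegreeAtMost d g → DegreeAtMost d (diff n g)
deg-diff {g = g} n Dg k d<k = trans (Δ₀-comm n k (λ y j → g (y ℕ.+ j)))
  (trans (Δ₀-cong n (λ j → deg-translate Dg j k d<k)) (Δ₀-zero n))

diff-linear : ∀ n a c f g y → diff n (λ z → a * f z + c * g z) y ≡ a * diff n f y + c * diff n g y
diff-linear n a c f g y = trans (Δ₀-+ n (λ j → a * f (y ℕ.+ j)) (λ j → c * g (y ℕ.+ j)))
  (cong₂ _+_ (Δ₀-* n a (λ j → f (y ℕ.+ j))) (Δ₀-* n c (λ j → g (y ℕ.+ j))))

diff-suc : ∀ n g y → diff n g (suc y) ≡ diff (suc n) g y + diff n g y
diff-suc n g y = trans (Δ₀-cong n (λ j → cong g (sym (NP.+-suc y j))))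
  (Δ₀-shift n (λ j → g (y ℕ.+ j)))

diff-mulIndex : ∀ n g y → diff n (λ z → ℕ→ℚ z * g z) y
                          ≡ ℕ→ℚ y * diff n g y + ℕ→ℚ n * (diff n g y + diff (ℕ.pred n) g y)
diff-mulIndex n g y =
  trans (Δ₀-cong n (λ j → trans (cong (_* g (y ℕ.+ j)) (ℕ→ℚ-+ y j)) (QP.*-distribʳ-+ (g (y ℕ.+ j)) (ℕ→ℚ y) (ℕ→ℚ j))))
  (trans (Δ₀-+ n (λ j → ℕ→ℚ y * g (y ℕ.+ j)) (λ j → ℕ→ℚ j * g (y ℕ.+ j)))
         (cong₂ _+_ (Δ₀-* n (ℕ→ℚ y) (λ j → g (y ℕ.+ j))) (indexPart n)))
  where
  indexPart : ∀ n → Δ₀ n (λ j → ℕ→ℚ j * g (y ℕ.+ j)) ≡ ℕ→ℚ n * (diff n g y + diff (ℕ.pred n) g y)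
  indexPart zero = trans (QP.*-zeroˡ (g (y ℕ.+ 0))) (sym (QP.*-zeroˡ (diff 0 g y + diff 0 g y)))
  indexPart (suc n) = trans (Δ₀-mulIndex n (λ j → g (y ℕ.+ j)))
    (cong (ℕ→ℚ (suc n) *_) (trans (Δ₀-cong n (λ j → cong g (NP.+-suc y j))) (diff-suc n g y)))

-- For a polynomial of
-- degree ≤ d the truncation K is irrelevant as soon as K ≥ d.
module DowlingFunctional (m : ℕ) .{{_ : NonZero m}} (t : ℚ) where
  open GeneratingSeries m t

  powm : ℕ → ℕ → ℚ
  powm i y = ℕ→ℚ ((m ℕ.* y ℕ.+ 1) ℕ.^ i)

  powm-suc : ∀ i y → powm (suc i) y ≡ powm i y + M * (ℕ→ℚ y * powm i y)
  powm-suc i y = trans (ℕ→ℚ-* (m ℕ.* y ℕ.+ 1) _)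
    (trans (cong (_* powm i y) (trans (ℕ→ℚ-+ (m ℕ.* y) 1) (cong (_+ 1ℚ) (ℕ→ℚ-* m y))))
      (solve 3 (λ M y x → (M :* y :+ con 1ℚ) :* x := x :+ M :* (y :* x)) refl M (ℕ→ℚ y) (powm i y)))

  powm-+ : ∀ i k y → powm (i ℕ.+ k) y ≡ powm i y * powm k y
  powm-+ i k y = trans (cong ℕ→ℚ (NP.^-distribˡ-+-* (m ℕ.* y ℕ.+ 1) i k))
    (ℕ→ℚ-* ((m ℕ.* y ℕ.+ 1) ℕ.^ i) ((m ℕ.* y ℕ.+ 1) ℕ.^ k))

  deg-powm : ∀ i → DegreeAtMost i (powm i)
  deg-powm zero = deg-const (ℕ→ℚ 1)
  deg-powm (suc i) = deg-cong (λ y → sym (powm-suc i y))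
    (deg-+ (deg-mono (NP.n≤1+n i) (deg-powm i)) (deg-* M (deg-mulIndex (deg-powm i))))

  Φ : ℕ → (ℕ → ℚ) → ℚ
  Φ K g = sumTo K (λ k → ip k * (t ^ℚ k * Δ₀ k g))

  Φ-cong : ∀ K {f g} → (∀ y → f y ≡ g y) → Φ K f ≡ Φ K g
  Φ-cong K f≡g = sum-cong K (λ k → cong (λ z → ip k * (t ^ℚ k * z)) (Δ₀-cong k f≡g))

  Φ-+ : ∀ K f g → Φ K (λ y → f y + g y) ≡ Φ K f + Φ K g
  Φ-+ K f g = trans (sum-cong K (λ k → trans (cong (λ z → ip k * (t ^ℚ k * z)) (Δ₀-+ k f g))
      (solve 4 (λ i T a b → i :* (T :* (a :+ b)) := i :* (T :* a) :+ i :* (T :* b)) refl (ip k) (t ^ℚ k) (Δ₀ k f) (Δ₀ k g))))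
    (sum-+ K _ _)

  Φ-* : ∀ K c f → Φ K (λ y → c * f y) ≡ c * Φ K f
  Φ-* K c f = trans (sum-cong K (λ k → trans (cong (λ z → ip k * (t ^ℚ k * z)) (Δ₀-* k c f))
      (solve 4 (λ i T c a → i :* (T :* (c :* a)) := c :* (i :* (T :* a))) refl (ip k) (t ^ℚ k) c (Δ₀ k f))))
    (sum-*ˡ K c _)

  Φ-sum : ∀ K n (G : ℕ → ℕ → ℚ) → Φ K (λ y → sumTo n (λ i → G i y)) ≡ sumTo n (λ i → Φ K (G i))
  Φ-sum K zero G = refl
  Φ-sum K (suc n) G = trans (Φ-+ K (λ y → sumTo n (λ i → G i y)) (G (suc n))) (cong (_+ Φ K (G (suc n))) (Φ-sum K n G))

  Φ-stable : ∀ {d g} K → DegreeAtMost d g → d ≤ K → Φ K g ≡ Φ d g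
  Φ-stable {d} {g} K Dg d≤K = sum-extend d K _ d≤K (λ k d<k →
    trans (cong (λ z → ip k * (t ^ℚ k * z)) (Dg k d<k)) (trans (cong (ip k *_) (QP.*-zeroʳ (t ^ℚ k))) (QP.*-zeroʳ (ip k))))

  -- D_m(i,t) = Φ_i(h_i), since m^k k! W_m(i,k) = Δ^k h_i(0)
  D≡Φ : ∀ i → D m i t ≡ Φ i (powm i)
  D≡Φ i = sum-cong i (λ k → trans (cong (λ z → ip k * z * (t ^ℚ k)) (sym (Δ₀-binomial k (powm i))))
     (solve 3 (λ i a T → i :* a :* T := i :* (T :* a)) refl (ip k) (Δ₀ k (powm i)) (t ^ℚ k)))

  Φ-mulIndex : ∀ K r → M * Φ (suc K) (λ y → ℕ→ℚ y * r y) ≡ t * Φ K (λ y → r (suc y))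
  Φ-mulIndex K r =
    begin
      M * Φ (suc K) (λ y → ℕ→ℚ y * r y)
    ≡⟨ cong (M *_) (trans (sum-head K _) (trans (cong (_+ tail) head≡0) (QP.+-identityˡ tail))) ⟩
      M * tail
    ≡⟨ sym (sum-*ˡ K M _) ⟩
      sumTo K (λ k → M * (ip (suc k) * (t ^ℚ suc k * Δ₀ (suc k) (λ y → ℕ→ℚ y * r y))))
    ≡⟨ sum-cong K term ⟩
      sumTo K (λ k → t * (ip k * (t ^ℚ k * Δ₀ k (λ y → r (suc y)))))
    ≡⟨ sum-*ˡ K t _ ⟩
      t * Φ K (λ y → r (suc y))
    ∎
    where
    open ≡-Reasoning
    tail = sumTo K (λ k → ip (suc k) * (t ^ℚ suc k * Δ₀ (suc k) (λ y → ℕ→ℚ y * r y)))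
    head≡0 : ip 0 * (t ^ℚ 0 * (ℕ→ℚ 0 * r 0)) ≡ 0ℚ
    head≡0 = solve 2 (λ T x → con 1ℚ :* (con 1ℚ :* (con 0ℚ :* x)) := con 0ℚ) refl t (r 0)
    term : ∀ k → M * (ip (suc k) * (t ^ℚ suc k * Δ₀ (suc k) (λ y → ℕ→ℚ y * r y)))
                 ≡ t * (ip k * (t ^ℚ k * Δ₀ k (λ y → r (suc y))))
    term k = trans (cong (λ z → M * (ip (suc k) * (t ^ℚ suc k * z))) (Δ₀-mulIndex k r))
      (trans (solve 6 (λ M i t tk s X → M :* (i :* ((t :* tk) :* (s :* X))) := t :* ((i :* (s :* M)) :* (tk :* X))) refl
                M (ip (suc k)) t (t ^ℚ k) (ℕ→ℚ (suc k)) (Δ₀ k (λ y → r (suc y))))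
      (cong (λ z → t * (z * (t ^ℚ k * Δ₀ k (λ y → r (suc y))))) (ip-suc k)))

  Q Qshift : ℕ → ℕ → ℚ
  Q n y = sumTo n (λ k → Rt n k * powm k y)
  Qshift n y = sumTo n (λ k → Rshift n k * powm k y)

  Qshift-suc : ∀ n y → Qshift (suc n) y ≡ ℕ→ℚ (suc n) * Q n y
  Qshift-suc n y =
    trans (sum-extend n (suc n) _ (NP.n≤1+n n) (λ k n<k →
             trans (cong (λ z → ℕ→ℚ (suc n) * z * powm k y) (R-vanish n k n<k))
                   (trans (cong (_* powm k y) (QP.*-zeroʳ (ℕ→ℚ (suc n)))) (QP.*-zeroˡ (powm k y)))))
    (trans (sum-cong n (λ k → QP.*-assoc (ℕ→ℚ (suc n)) (Rt n k) (powm k y))) (sum-*ˡ n (ℕ→ℚ (suc n)) _))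

  -- Q_{n+1}(y) = (my - mn - t) Q_n(y) - t m Σ_k n R_{n-1,k} h_k(y), from R-rec and h_{k+1} = (1+my) h_k
  Q-rec : ∀ n y → Q (suc n) y ≡ (M * ℕ→ℚ y - M * ℕ→ℚ n - t) * Q n y - t * M * Qshift n y
  Q-rec n y =
    begin
      Q (suc n) y
    ≡⟨ trans (sum-cong (suc n) (λ k → trans (cong (_* powm k y) (R-rec n k))
                (QP.*-distribʳ-+ (powm k y) (α * Rt n k - t * M * Rshift n k) (Rprev n k))))
             (sum-+ (suc n) _ _) ⟩
      sumTo (suc n) (λ k → (α * Rt n k - t * M * Rshift n k) * powm k y) + sumTo (suc n) (λ k → Rprev n k * powm k y)
    ≡⟨ cong₂ _+_ currentSum previousSum ⟩
      (α * Q n y + (- (t * M)) * Qshift n y) + (1ℚ + M * ℕ→ℚ y) * Q n y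
    ≡⟨ solve 6 (λ T M n y q z → ((:- (T :+ con 1ℚ :+ M :* n)) :* q :+ (:- (T :* M)) :* z) :+ (con 1ℚ :+ M :* y) :* q
                 := (M :* y :- M :* n :- T) :* q :- T :* M :* z) refl t M (ℕ→ℚ n) (ℕ→ℚ y) (Q n y) (Qshift n y) ⟩
      (M * ℕ→ℚ y - M * ℕ→ℚ n - t) * Q n y - t * M * Qshift n y
    ∎
    where
    open ≡-Reasoning
    α = - (t + 1ℚ + M * ℕ→ℚ n)
    currentSum : sumTo (suc n) (λ k → (α * Rt n k - t * M * Rshift n k) * powm k y) ≡ α * Q n y + (- (t * M)) * Qshift n y
    currentSum =
      trans (sum-extend n (suc n) _ (NP.n≤1+n n) (λ k n<k →
               trans (cong₂ (λ u v → (α * u - t * M * v) * powm k y) (R-vanish n k n<k) (Rshift-vanish n k n<k))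
                     (solve 4 (λ a T M x → (a :* con 0ℚ :- T :* M :* con 0ℚ) :* x := con 0ℚ) refl α t M (powm k y))))
      (trans (sum-cong n (λ k → solve 5 (λ a R T Z x → (a :* R :- T :* Z) :* x := a :* (R :* x) :+ (:- T) :* (Z :* x)) refl
                                   α (Rt n k) (t * M) (Rshift n k) (powm k y)))
      (trans (sum-+ n _ _) (cong₂ _+_ (sum-*ˡ n α _) (sum-*ˡ n (- (t * M)) _))))
    previousSum : sumTo (suc n) (λ k → Rprev n k * powm k y) ≡ (1ℚ + M * ℕ→ℚ y) * Q n y
    previousSum =
      trans (sum-head n (λ k → Rprev n k * powm k y))
      (trans (cong (_+ sumTo n (λ k → Rt n k * powm (suc k) y)) (QP.*-zeroˡ (powm 0 y)))
      (trans (QP.+-identityˡ _)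
      (trans (sum-cong n (λ k → trans (cong (Rt n k *_) (powm-suc k y))
                (solve 4 (λ R x M y → R :* (x :+ M :* (y :* x)) := (con 1ℚ :+ M :* y) :* (R :* x)) refl (Rt n k) (powm k y) M (ℕ→ℚ y))))
             (sum-*ˡ n (1ℚ + M * ℕ→ℚ y) _))))

  twist : ℕ → (ℕ → ℚ) → ℕ → ℚ
  twist n g y = (M * ℕ→ℚ y - M * ℕ→ℚ n - t) * g y

  twist-split : ∀ n g y → M * (ℕ→ℚ y * g y) + (- (M * ℕ→ℚ n + t)) * g y ≡ twist n g y
  twist-split n g y = solve 5 (λ M y n t g → M :* (y :* g) :+ (:- (M :* n :+ t)) :* g := (M :* y :- M :* n :- t) :* g) refl
    M (ℕ→ℚ y) (ℕ→ℚ n) t (g y)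

  deg-twist : ∀ {d g} n → DegreeAtMost d g → DegreeAtMost (suc d) (twist n g)
  deg-twist n Dg = deg-cong (twist-split n _)
    (deg-+ (deg-* M (deg-mulIndex Dg)) (deg-mono (NP.n≤1+n _) (deg-* (- (M * ℕ→ℚ n + t)) Dg)))

  diff-twist : ∀ n g y → diff n (twist n g) y
                        ≡ M * (ℕ→ℚ y * diff n g y) + ((M * ℕ→ℚ n) * diff (ℕ.pred n) g y + (- t) * diff n g y)
  diff-twist n g y =
    begin
      diff n (twist n g) y
    ≡⟨ Δ₀-cong n (λ j → sym (twist-split n g (y ℕ.+ j))) ⟩
      diff n (λ z → M * (ℕ→ℚ z * g z) + c * g z) y
    ≡⟨ diff-linear n M c (λ z → ℕ→ℚ z * g z) g y ⟩
      M * diff n (λ z → ℕ→ℚ z * g z) y + c * r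
    ≡⟨ cong (λ z → M * z + c * r) (diff-mulIndex n g y) ⟩
      M * (ℕ→ℚ y * r + ℕ→ℚ n * (r + p)) + c * r
    ≡⟨ solve 6 (λ M y r n p t → M :* (y :* r :+ n :* (r :+ p)) :+ (:- (M :* n :+ t)) :* r := M :* (y :* r) :+ ((M :* n) :* p :+ (:- t) :* r))
         refl M (ℕ→ℚ y) r (ℕ→ℚ n) p t ⟩
      M * (ℕ→ℚ y * r) + ((M * ℕ→ℚ n) * p + (- t) * r)
    ∎
    where
    open ≡-Reasoning
    c = - (M * ℕ→ℚ n + t)
    r = diff n g y
    p = diff (ℕ.pred n) g y

  Φ-diff-twist : ∀ {d g} n K → DegreeAtMost d g → d ℕ.+ suc n ≤ suc K →
    Φ (suc K) (diff n (twist n g))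
      ≡ t * (Φ (suc K) (diff (suc n) g) + Φ (suc K) (diff n g))
        + ((M * ℕ→ℚ n) * Φ (suc K) (diff (ℕ.pred n) g) + (- t) * Φ (suc K) (diff n g))
  Φ-diff-twist {d} {g} n K Dg bound =
    begin
      Φ (suc K) (diff n (twist n g))
    ≡⟨ Φ-cong (suc K) (diff-twist n g) ⟩
      Φ (suc K) (λ y → M * (ℕ→ℚ y * r y) + ((M * ℕ→ℚ n) * p y + (- t) * r y))
    ≡⟨ trans (Φ-+ (suc K) _ _) (cong₂ _+_ (Φ-* (suc K) M _)
         (trans (Φ-+ (suc K) _ _) (cong₂ _+_ (Φ-* (suc K) (M * ℕ→ℚ n) p) (Φ-* (suc K) (- t) r)))) ⟩
      M * Φ (suc K) (λ y → ℕ→ℚ y * r y) + ((M * ℕ→ℚ n) * Φ (suc K) p + (- t) * Φ (suc K) r)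
    ≡⟨ cong (_+ ((M * ℕ→ℚ n) * Φ (suc K) p + (- t) * Φ (suc K) r)) shifted ⟩
      t * (Φ (suc K) (diff (suc n) g) + Φ (suc K) r) + ((M * ℕ→ℚ n) * Φ (suc K) p + (- t) * Φ (suc K) r)
    ∎
    where
    open ≡-Reasoning
    r = diff n g
    p = diff (ℕ.pred n) g
    d≤K : d ≤ K
    d≤K = NP.≤-trans (NP.m≤m+n d n) (NP.≤-pred (subst (_≤ suc K) (NP.+-suc d n) bound))
    deg-r-suc : DegreeAtMost d (λ y → r (suc y))
    deg-r-suc = deg-suc (deg-diff n Dg)
    -- y r(y) shifts Φ by one step; truncating at K or K+1 is the same for degree d ≤ K
    shifted : M * Φ (suc K) (λ y → ℕ→ℚ y * r y) ≡ t * (Φ (suc K) (diff (suc n) g) + Φ (suc K) r)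
    shifted = trans (Φ-mulIndex K r) (cong (t *_)
      (trans (trans (Φ-stable K deg-r-suc d≤K) (sym (Φ-stable (suc K) deg-r-suc (NP.m≤n⇒m≤1+n d≤K))))
             (trans (Φ-cong (suc K) (diff-suc n g)) (Φ-+ (suc K) (diff (suc n) g) r))))

  Reduces : ℕ → Set
  Reduces n = ∀ d g K → DegreeAtMost d g → d ℕ.+ n ≤ K →
    Φ K (λ y → g y * Q n y) ≡ t ^ℚ n * Φ K (diff n g)

  ReducesShift : ℕ → Set
  ReducesShift n = ∀ d g K → DegreeAtMost d g → d ℕ.+ n ≤ K →
    t * Φ K (λ y → g y * Qshift n y) ≡ t ^ℚ n * ℕ→ℚ n * Φ K (diff (ℕ.pred n) g)

  reduces-zero : Reduces 0
  reduces-zero d g K _ _ = trans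
    (Φ-cong K (λ y → trans (cong (g y *_) (QP.*-identityˡ 1ℚ)) (trans (QP.*-identityʳ (g y)) (cong g (sym (NP.+-identityʳ y))))))
    (sym (QP.*-identityˡ _))

  reducesShift-zero : ReducesShift 0
  reducesShift-zero d g K _ _ =
    trans (cong (t *_) (trans (Φ-cong K (λ y → trans (cong (g y *_) (QP.*-zeroˡ (powm 0 y)))
                                             (trans (QP.*-zeroʳ (g y)) (sym (QP.*-zeroˡ (g y))))))
                              (trans (Φ-* K 0ℚ g) (QP.*-zeroˡ (Φ K g)))))
    (solve 2 (λ t X → t :* con 0ℚ := con 1ℚ :* con 0ℚ :* X) refl t (Φ K (diff 0 g)))

  reducesShift-suc : ∀ n → Reduces n → ReducesShift (suc n)
  reducesShift-suc n reduces-n d g K Dg bound =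
    begin
      t * Φ K (λ y → g y * Qshift (suc n) y)
    ≡⟨ cong (t *_) (trans (Φ-cong K (λ y → trans (cong (g y *_) (Qshift-suc n y))
           (solve 3 (λ g s q → g :* (s :* q) := s :* (g :* q)) refl (g y) (ℕ→ℚ (suc n)) (Q n y)))) (Φ-* K (ℕ→ℚ (suc n)) _)) ⟩
      t * (ℕ→ℚ (suc n) * Φ K (λ y → g y * Q n y))
    ≡⟨ cong (λ z → t * (ℕ→ℚ (suc n) * z)) (reduces-n d g K Dg (NP.≤-trans (NP.+-monoʳ-≤ d (NP.n≤1+n n)) bound)) ⟩
      t * (ℕ→ℚ (suc n) * (t ^ℚ n * Φ K (diff n g)))
    ≡⟨ solve 4 (λ t s tn X → t :* (s :* (tn :* X)) := (t :* tn) :* s :* X) refl t (ℕ→ℚ (suc n)) (t ^ℚ n) (Φ K (diff n g)) ⟩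
      t ^ℚ suc n * ℕ→ℚ (suc n) * Φ K (diff n g)
    ∎
    where open ≡-Reasoning

  -- Induction step: Q-rec writes g Q_{n+1} as (twist g) Q_n plus a Qshift term.
  reduces-suc : ∀ n → Reduces n → ReducesShift n → Reduces (suc n)
  reduces-suc n _ _ d g zero Dg bound with subst (_≤ 0) (NP.+-suc d n) bound
  ... | ()
  reduces-suc n reduces-n reducesShift-n d g (suc K) Dg bound =
    begin
      Φ (suc K) (λ y → g y * Q (suc n) y)
    ≡⟨ Φ-cong (suc K) (λ y → trans (cong (g y *_) (Q-rec n y))
          (solve 7 (λ g M y n t q z → g :* ((M :* y :- M :* n :- t) :* q :- t :* M :* z)
               := (M :* y :- M :* n :- t) :* g :* q :+ (:- (t :* M)) :* (g :* z))
             refl (g y) M (ℕ→ℚ y) (ℕ→ℚ n) t (Q n y) (Qshift n y))) ⟩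
      Φ (suc K) (λ y → twist n g y * Q n y + (- (t * M)) * (g y * Qshift n y))
    ≡⟨ trans (Φ-+ (suc K) _ _) (cong (λ z → Φ (suc K) (λ y → twist n g y * Q n y) + z) (Φ-* (suc K) (- (t * M)) _)) ⟩
      Φ (suc K) (λ y → twist n g y * Q n y) + (- (t * M)) * Φ (suc K) (λ y → g y * Qshift n y)
    ≡⟨ cong₂ _+_ (reduces-n (suc d) (twist n g) (suc K) (deg-twist n Dg) (subst (_≤ suc K) (NP.+-suc d n) bound))
           (trans (solve 3 (λ t M X → (:- (t :* M)) :* X := (:- M) :* (t :* X)) refl t M (Φ (suc K) (λ y → g y * Qshift n y)))
                  (cong ((- M) *_) (reducesShift-n d g (suc K) Dg (NP.≤-trans (NP.+-monoʳ-≤ d (NP.n≤1+n n)) bound)))) ⟩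
      t ^ℚ n * Φ (suc K) (diff n (twist n g)) + (- M) * (t ^ℚ n * ℕ→ℚ n * Φ (suc K) p)
    ≡⟨ cong (λ z → t ^ℚ n * z + (- M) * (t ^ℚ n * ℕ→ℚ n * Φ (suc K) p)) (Φ-diff-twist n K Dg bound) ⟩
      t ^ℚ n * (t * (Φ (suc K) (diff (suc n) g) + Φ (suc K) r) + ((M * ℕ→ℚ n) * Φ (suc K) p + (- t) * Φ (suc K) r))
        + (- M) * (t ^ℚ n * ℕ→ℚ n * Φ (suc K) p)
    ≡⟨ solve 7 (λ tn t A B M n C → tn :* (t :* (A :+ B) :+ ((M :* n) :* C :+ (:- t) :* B)) :+ (:- M) :* (tn :* n :* C) := (t :* tn) :* A)
         refl (t ^ℚ n) t (Φ (suc K) (diff (suc n) g)) (Φ (suc K) r) M (ℕ→ℚ n) (Φ (suc K) p) ⟩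
      t ^ℚ suc n * Φ (suc K) (diff (suc n) g)
    ∎
    where
    open ≡-Reasoning
    r = diff n g
    p = diff (ℕ.pred n) g

  reduces : ∀ n → Reduces n
  reducesShift : ∀ n → ReducesShift n
  reduces zero = reduces-zero
  reduces (suc n) = reduces-suc n (reduces n) (reducesShift n)
  reducesShift zero = reducesShift-zero
  reducesShift (suc n) = reducesShift-suc n (reduces n)

  -- Δ^n h_i via the binomial theorem and Δ^n y^r(0) = n! S(r,n).
  stirlingCoeff : ℕ → ℕ → ℕ → ℚ
  stirlingCoeff n i l = ℕ→ℚ (m ℕ.^ (i ∸ l) ℕ.* (i C l) ℕ.* S (i ∸ l) n)

  powm-translate : ∀ i y j → powm i (y ℕ.+ j)
                   ≡ sumTo i (λ l → (ℕ→ℚ (i C l) * powm l y * ℕ→ℚ (m ℕ.^ (i ∸ l))) * ℕ→ℚ (j ℕ.^ (i ∸ l)))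
  powm-translate i y j =
    begin
      ℕ→ℚ ((m ℕ.* (y ℕ.+ j) ℕ.+ 1) ℕ.^ i)
    ≡⟨ cong (λ z → ℕ→ℚ (z ℕ.^ i))
         (solveℕ 3 (λ m y j → m ⊗ (y ⊕ j) ⊕ conℕ 1 ≐ (m ⊗ y ⊕ conℕ 1) ⊕ m ⊗ j) refl m y j) ⟩
      ℕ→ℚ (((m ℕ.* y ℕ.+ 1) ℕ.+ m ℕ.* j) ℕ.^ i)
    ≡⟨ trans (ℕ→ℚ-^ _ i) (cong (_^ℚ i) (ℕ→ℚ-+ (m ℕ.* y ℕ.+ 1) (m ℕ.* j))) ⟩
      (ℕ→ℚ (m ℕ.* y ℕ.+ 1) + ℕ→ℚ (m ℕ.* j)) ^ℚ i
    ≡⟨ binomial i _ _ ⟩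
      sumTo i (λ l → ℕ→ℚ (i C l) * (ℕ→ℚ (m ℕ.* y ℕ.+ 1) ^ℚ l * ℕ→ℚ (m ℕ.* j) ^ℚ (i ∸ l)))
    ≡⟨ sum-cong i (λ l → cong₂ (λ u v → ℕ→ℚ (i C l) * (u * v)) (sym (ℕ→ℚ-^ (m ℕ.* y ℕ.+ 1) l)) (mj^ (i ∸ l))) ⟩
      sumTo i (λ l → ℕ→ℚ (i C l) * (powm l y * (ℕ→ℚ (m ℕ.^ (i ∸ l)) * ℕ→ℚ (j ℕ.^ (i ∸ l)))))
    ≡⟨ sum-cong i (λ l → solve 4 (λ C h a b → C :* (h :* (a :* b)) := (C :* h :* a) :* b) refl
                             (ℕ→ℚ (i C l)) (powm l y) (ℕ→ℚ (m ℕ.^ (i ∸ l))) (ℕ→ℚ (j ℕ.^ (i ∸ l)))) ⟩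
      sumTo i (λ l → (ℕ→ℚ (i C l) * powm l y * ℕ→ℚ (m ℕ.^ (i ∸ l))) * ℕ→ℚ (j ℕ.^ (i ∸ l)))
    ∎
    where
    open ≡-Reasoning
    open NS.+-*-Solver using () renaming (con to conℕ; solve to solveℕ; _:*_ to _⊗_; _:+_ to _⊕_; _:=_ to _≐_)
    mj^ : ∀ r → ℕ→ℚ (m ℕ.* j) ^ℚ r ≡ ℕ→ℚ (m ℕ.^ r) * ℕ→ℚ (j ℕ.^ r)
    mj^ r = trans (cong (_^ℚ r) (ℕ→ℚ-* m j))
      (trans (^ℚ-distrib-* M (ℕ→ℚ j) r) (sym (cong₂ _*_ (ℕ→ℚ-^ m r) (ℕ→ℚ-^ j r))))

  diff-powm : ∀ n i y → diff n (powm i) y ≡ ℕ→ℚ (n ℕ.!) * sumTo i (λ l → stirlingCoeff n i l * powm l y)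
  diff-powm n i y =
    begin
      Δ₀ n (λ j → powm i (y ℕ.+ j))
    ≡⟨ trans (Δ₀-cong n (powm-translate i y)) (Δ₀-sum i n _) ⟩
      sumTo i (λ l → Δ₀ n (λ j → a l * ℕ→ℚ (j ℕ.^ (i ∸ l))))
    ≡⟨ sum-cong i (λ l → trans (Δ₀-* n (a l) (λ j → ℕ→ℚ (j ℕ.^ (i ∸ l)))) (cong (a l *_) (Δ₀-power (i ∸ l) n))) ⟩
      sumTo i (λ l → a l * (ℕ→ℚ (n ℕ.!) * ℕ→ℚ (S (i ∸ l) n)))
    ≡⟨ sum-cong i regroup ⟩
      sumTo i (λ l → ℕ→ℚ (n ℕ.!) * (stirlingCoeff n i l * powm l y))
    ≡⟨ sum-*ˡ i (ℕ→ℚ (n ℕ.!)) _ ⟩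
      ℕ→ℚ (n ℕ.!) * sumTo i (λ l → stirlingCoeff n i l * powm l y)
    ∎
    where
    open ≡-Reasoning
    a : ℕ → ℚ
    a l = ℕ→ℚ (i C l) * powm l y * ℕ→ℚ (m ℕ.^ (i ∸ l))
    regroup : ∀ l → a l * (ℕ→ℚ (n ℕ.!) * ℕ→ℚ (S (i ∸ l) n)) ≡ ℕ→ℚ (n ℕ.!) * (stirlingCoeff n i l * powm l y)
    regroup l = trans
      (solve 5 (λ C h Mp nf s → (C :* h :* Mp) :* (nf :* s) := nf :* ((Mp :* C :* s) :* h)) refl
         (ℕ→ℚ (i C l)) (powm l y) (ℕ→ℚ (m ℕ.^ (i ∸ l))) (ℕ→ℚ (n ℕ.!)) (ℕ→ℚ (S (i ∸ l) n)))
      (cong (λ z → ℕ→ℚ (n ℕ.!) * (z * powm l y))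
        (sym (trans (ℕ→ℚ-* (m ℕ.^ (i ∸ l) ℕ.* (i C l)) (S (i ∸ l) n))
                    (cong (_* ℕ→ℚ (S (i ∸ l) n)) (ℕ→ℚ-* (m ℕ.^ (i ∸ l)) (i C l))))))

  -- Σ_k R_{n,k} D_m(i+k) = Φ(h_i Q_n), using D_m(i+k) = Φ(h_{i+k}) and h_{i+k} = h_i h_k
  sumRD≡Φ : ∀ n i → sumTo n (λ k → Rt n k * D m (i ℕ.+ k) t) ≡ Φ (i ℕ.+ n) (λ y → powm i y * Q n y)
  sumRD≡Φ n i =
    begin
      sumTo n (λ k → Rt n k * D m (i ℕ.+ k) t)
    ≡⟨ sum-cong≤ n (λ k k≤n → cong (Rt n k *_)
         (trans (D≡Φ (i ℕ.+ k)) (sym (Φ-stable K (deg-powm (i ℕ.+ k)) (NP.+-monoʳ-≤ i k≤n))))) ⟩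
      sumTo n (λ k → Rt n k * Φ K (powm (i ℕ.+ k)))
    ≡⟨ sym (trans (Φ-sum K n (λ k y → Rt n k * powm (i ℕ.+ k) y)) (sum-cong n (λ k → Φ-* K (Rt n k) (powm (i ℕ.+ k))))) ⟩
      Φ K (λ y → sumTo n (λ k → Rt n k * powm (i ℕ.+ k) y))
    ≡⟨ Φ-cong K (λ y → trans (sum-cong n (λ k → trans (cong (Rt n k *_) (powm-+ i k y))
            (solve 3 (λ R a b → R :* (a :* b) := a :* (R :* b)) refl (Rt n k) (powm i y) (powm k y)))) (sum-*ˡ n (powm i y) _)) ⟩
      Φ K (λ y → powm i y * Q n y)
    ∎
    where
    open ≡-Reasoning
    K = i ℕ.+ n

  Φ-diff-powm : ∀ n i → Φ (i ℕ.+ n) (diff n (powm i)) ≡ ℕ→ℚ (n ℕ.!) * sumTo i (λ j → stirlingCoeff n i j * D m j t)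
  Φ-diff-powm n i =
    trans (Φ-cong K (diff-powm n i))
    (trans (Φ-* K (ℕ→ℚ (n ℕ.!)) _)
    (cong (ℕ→ℚ (n ℕ.!) *_)
      (trans (Φ-sum K i (λ l y → stirlingCoeff n i l * powm l y))
      (sum-cong≤ i (λ l l≤i → trans (Φ-* K (stirlingCoeff n i l) (powm l))
        (cong (stirlingCoeff n i l *_)
          (trans (Φ-stable K (deg-powm l) (NP.≤-trans l≤i (NP.m≤m+n i n))) (sym (D≡Φ l)))))))))
    where
    K = i ℕ.+ n

  expansion : ∀ n i → sumTo n (λ k → R m n k t * D m (i ℕ.+ k) t)
                      ≡ (t ^ℚ n) * ℕ→ℚ (n ℕ.!) * sumTo i (λ j → stirlingCoeff n i j * D m j t)
  expansion n i =
    begin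
      sumTo n (λ k → Rt n k * D m (i ℕ.+ k) t)
    ≡⟨ sumRD≡Φ n i ⟩
      Φ (i ℕ.+ n) (λ y → powm i y * Q n y)
    ≡⟨ reduces n i (powm i) (i ℕ.+ n) (deg-powm i) NP.≤-refl ⟩
      t ^ℚ n * Φ (i ℕ.+ n) (diff n (powm i))
    ≡⟨ cong (t ^ℚ n *_) (Φ-diff-powm n i) ⟩
      t ^ℚ n * (ℕ→ℚ (n ℕ.!) * sumTo i (λ j → stirlingCoeff n i j * D m j t))
    ≡⟨ sym (QP.*-assoc (t ^ℚ n) _ _) ⟩
      (t ^ℚ n) * ℕ→ℚ (n ℕ.!) * sumTo i (λ j → stirlingCoeff n i j * D m j t)
    ∎
    where open ≡-Reasoning

  stirlingCoeff-vanish : ∀ n i j X → S (i ∸ j) n ≡ 0 → stirlingCoeff n i j * X ≡ 0ℚ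
  stirlingCoeff-vanish n i j X S≡0 =
    trans (cong (λ z → ℕ→ℚ (m ℕ.^ (i ∸ j) ℕ.* (i C j) ℕ.* z) * X) S≡0)
    (trans (cong (λ z → ℕ→ℚ z * X) (NP.*-zeroʳ (m ℕ.^ (i ∸ j) ℕ.* (i C j)))) (QP.*-zeroˡ X))

  -- For i = n only j = 0 survives, contributing m^n S(n,n) D_m(0,t) = m^n.
  diagonal-constantTerm : ∀ n → stirlingCoeff n n 0 * D m 0 t ≡ ℕ→ℚ (m ℕ.^ n)
  diagonal-constantTerm n = trans (cong (λ z → ℕ→ℚ (m ℕ.^ n ℕ.* 1 ℕ.* z) * 1ℚ) (S-diag n))
    (trans (QP.*-identityʳ _) (cong ℕ→ℚ (trans (NP.*-identityʳ (m ℕ.^ n ℕ.* 1)) (NP.*-identityʳ (m ℕ.^ n)))))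

  diagonal-sum : ∀ n → sumTo n (λ j → stirlingCoeff n n j * D m j t) ≡ ℕ→ℚ (m ℕ.^ n)
  diagonal-sum zero = diagonal-constantTerm 0
  diagonal-sum (suc n) = trans (sum-extend 0 (suc n) _ z≤n higherTerm) (diagonal-constantTerm (suc n))
    where
    higherTerm : ∀ j → 0 < j → stirlingCoeff (suc n) (suc n) j * D m j t ≡ 0ℚ
    higherTerm (suc j) _ = stirlingCoeff-vanish (suc n) (suc n) (suc j) (D m (suc j) t)
      (S-vanish (n ∸ j) (suc n) (s≤s (NP.m∸n≤m n j)))

  diagonal : ∀ n → sumTo n (λ k → R m n k t * D m (n ℕ.+ k) t) ≡ ℕ→ℚ (n ℕ.! ℕ.* m ℕ.^ n) * (t ^ℚ n)
  diagonal n =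
    begin
      sumTo n (λ k → Rt n k * D m (n ℕ.+ k) t)
    ≡⟨ expansion n n ⟩
      (t ^ℚ n) * ℕ→ℚ (n ℕ.!) * sumTo n (λ j → stirlingCoeff n n j * D m j t)
    ≡⟨ cong ((t ^ℚ n) * ℕ→ℚ (n ℕ.!) *_) (diagonal-sum n) ⟩
      (t ^ℚ n) * ℕ→ℚ (n ℕ.!) * ℕ→ℚ (m ℕ.^ n)
    ≡⟨ solve 3 (λ T a b → T :* a :* b := (a :* b) :* T) refl (t ^ℚ n) (ℕ→ℚ (n ℕ.!)) (ℕ→ℚ (m ℕ.^ n)) ⟩
      (ℕ→ℚ (n ℕ.!) * ℕ→ℚ (m ℕ.^ n)) * (t ^ℚ n)
    ≡⟨ cong (_* (t ^ℚ n)) (sym (ℕ→ℚ-* (n ℕ.!) (m ℕ.^ n))) ⟩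
      ℕ→ℚ (n ℕ.! ℕ.* m ℕ.^ n) * (t ^ℚ n)
    ∎
    where open ≡-Reasoning

  -- For i < n every S(i-j, n) vanishes.
  belowDiagonal : ∀ n i → i < n → sumTo n (λ k → R m n k t * D m (i ℕ.+ k) t) ≡ 0ℚ
  belowDiagonal n i i<n =
    trans (expansion n i)
    (trans (cong ((t ^ℚ n) * ℕ→ℚ (n ℕ.!) *_)
             (sum-vanish i _ (λ j _ → stirlingCoeff-vanish n i j (D m j t) (S-vanish (i ∸ j) n (NP.≤-<-trans (NP.m∸n≤m i j) i<n)))))
           (QP.*-zeroʳ ((t ^ℚ n) * ℕ→ℚ (n ℕ.!))))

mainTheorem14 : (m : ℕ) .{{_ : NonZero m}} (t : ℚ) →
    ((n i : ℕ) →
      sumTo n (λ k → R m n k t * D m (i ℕ.+ k) t)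
        ≡ (t ^ℚ n) * ℕ→ℚ (n ℕ.!)
            * sumTo i (λ j → ℕ→ℚ (m ℕ.^ (i ∸ j) ℕ.* (i C j) ℕ.* S (i ∸ j) n) * D m j t))
    × ((n : ℕ) →
      sumTo n (λ k → R m n k t * D m (n ℕ.+ k) t)
        ≡ ℕ→ℚ (n ℕ.! ℕ.* m ℕ.^ n) * (t ^ℚ n))
    × ((n i : ℕ) → i < n →
      sumTo n (λ k → R m n k t * D m (i ℕ.+ k) t) ≡ 0ℚ)
mainTheorem14 m t = expansion , diagonal , belowDiagonal
  where open DowlingFunctional m t
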